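{- Let $p$ be a prime, let $f \in \mathbf{F}_p[X]$ have degree $n > 0$, and write $p = \sum_{j=0}^{s} \varepsilon_j 2^j$ with $\varepsilon_j \in \{0,1\}$ (the binary digits of $p$). Suppose we are given polynomials in $\mathbf{F}_p[X]$: $h_0, \ldots, h_n$; $g_{ij}$ for $0 \leq i < n$, $0 \leq j < s$; $h'_{ij}$ for $0 \leq i < n$, $0 \leq j \leq s$; and $a_k, b_k$ for $0 \leq k < n$, such that: (i) for all $0 \leq i < n$: $h'_{is} = h_i^{\varepsilon_s}$ and $h'_{i0} = h_{i+1}$; (ii) for all $0 \leq i < n$ and $0 \leq j < s$: $f \cdot g_{ij} = (h'_{i(j+1)})^2 \cdot h_i^{\varepsilon_j} - h'_{ij}$; (iii) $h_0 = X$ and $h_n = X$; (iv) for every prime $t$ dividing $n$: $a_{n/t}\, f + b_{n/t}\,(h_{n/t} - X) = 1$. Then $f$ is irreducible in $\mathbf{F}_p[X]$.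
   Context: $\mathbf{F}_p$ denotes the field with $p$ elements. -}

module Defs where

open import Data.Nat as ℕ using (ℕ; zero; suc; _<_; _≤_)
open import Data.Nat.DivMod using (_/_; _%_)
open import Data.Integer as ℤ using (ℤ; +_; -_)
open import Data.Integer.Divisibility using (_∣_)
open import Data.List using (List; []; _∷_)
open import Data.Product using (Σ; ∃; _×_)
open import Data.Sum using (_⊎_)
open import Relation.Nullary using (¬_)

-- Polynomials over F_p are modelled as integer coefficient lists
-- (constant term first), i.e. as elements of ℤ[X], and F_p[X] is the
-- quotient ℤ[X]/(p) realised as the setoid relation _≈[_]_ below.
Poly : Set
Poly = List ℤ

infixl 6 _+P_ _-P_
infixl 7 _*P_ _·P_
infixr 8 _^P_

_+P_ : Poly → Poly → Poly
[]       +P g        = g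
f        +P []       = f
(a ∷ f)  +P (b ∷ g)  = (a ℤ.+ b) ∷ (f +P g)

-P_ : Poly → Poly
-P []      = []
-P (a ∷ f) = (ℤ.- a) ∷ (-P f)

_-P_ : Poly → Poly → Poly
f -P g = f +P (-P g)

_·P_ : ℤ → Poly → Poly
c ·P []      = []
c ·P (a ∷ f) = (c ℤ.* a) ∷ (c ·P f)

_*P_ : Poly → Poly → Poly
[]      *P g = []
(a ∷ f) *P g = (a ·P g) +P (ℤ.+ 0 ∷ (f *P g))

0P : Poly
0P = []

1P : Poly
1P = ℤ.+ 1 ∷ []

XP : Poly
XP = ℤ.+ 0 ∷ ℤ.+ 1 ∷ []

_^P_ : Poly → ℕ → Poly
f ^P zero  = 1P
f ^P suc e = f *P (f ^P e)

coeff : Poly → ℕ → ℤ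
coeff []      k       = ℤ.+ 0
coeff (a ∷ f) zero    = a
coeff (a ∷ f) (suc k) = coeff f k

_≈[_]_ : Poly → ℕ → Poly → Set
f ≈[ p ] g = ∀ k → (ℤ.+ p) ∣ (coeff f k ℤ.- coeff g k)

HasDegree : ℕ → Poly → ℕ → Set
HasDegree p f n = ¬ ((ℤ.+ p) ∣ coeff f n) × (∀ k → n < k → (ℤ.+ p) ∣ coeff f k)

IsUnit : ℕ → Poly → Set
IsUnit p g = ∃ λ u → (g *P u) ≈[ p ] 1P

Irreducible : ℕ → Poly → Set
Irreducible p f =
  ¬ (f ≈[ p ] 0P) × ¬ IsUnit p f ×
  (∀ g h → f ≈[ p ] (g *P h) → IsUnit p g ⊎ IsUnit p h)

bit : ℕ → ℕ → ℕ
bit m zero    = m % 2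
bit m (suc j) = bit (m / 2) j

-- The certificate computes h i ≡ X ^ (p ^ i) (mod f) by
-- square-and-multiply along the binary digits of p, so X ^ (p ^ n) ≡ X (mod f) and, for every
-- prime t ∣ n, X ^ (p ^ (n / t)) - X is invertible modulo f.  Suppose f had a factor of degree
-- 0 < d < n and let g be one of least degree.  Then 𝔽ₚ[X]/(g) has no zero divisors, and by the
-- Frobenius identity u(x ^ p) = u(x) ^ p the elements X ^ (p ^ i), i < n, are roots of g there.
-- They are pairwise distinct: the set of e with X ^ (p ^ e) ≡ X (mod g) contains n and is closed
-- under sums and differences, hence under gcd, so a coincidence would put a proper divisor of n
-- in it, and with it some n / t with t prime; but X ^ (p ^ (n / t)) - X is invertible modulo g.
-- So g, of degree d < n, would have n distinct roots in a domain.
module Submission where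

open import Defs
open import Level using (_⊔_)
open import Algebra.Bundles using (AbelianGroup; CommutativeRing)
import Algebra.Properties.AbelianGroup as AbelianGroupProperties
import Algebra.Properties.CommutativeSemigroup as CommutativeSemigroupProperties
import Algebra.Properties.CommutativeSemiring.Binomial as BinomialTheorem
import Algebra.Properties.CommutativeSemiring.Exp as CommutativeSemiringExpProperties
import Algebra.Properties.Monoid.Sum as MonoidSumProperties
import Algebra.Properties.Ring as RingProperties
import Algebra.Properties.Semiring.Exp as SemiringExpProperties
import Algebra.Properties.Semiring.Mult as SemiringMultProperties
open import Algebra.Solver.Ring.AlmostCommutativeRing using (fromCommutativeRing; _-Raw-AlmostCommutative⟶_)
import Algebra.Solver.Ring
open import Data.Empty using (⊥; ⊥-elim)
open import Data.Fin as Fin using (toℕ; fromℕ; inject₁)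
import Data.Fin.Properties as Finₚ
open import Data.Integer as ℤ using (ℤ; +_; -[1+_])
open import Data.Integer.Divisibility.Signed as ℤ∣ using (_∣_; divides)
import Data.Integer.Properties as ℤₚ
open import Data.Integer.Solver using (module +-*-Solver)
open import Data.List using (List; []; _∷_; length; take; map; applyUpTo)
import Data.List.Properties as Listₚ
open import Data.List.Relation.Unary.All as All using (All; []; _∷_)
import Data.List.Relation.Unary.All.Properties as Allₚ
open import Data.List.Relation.Unary.AllPairs using (AllPairs; []; _∷_)
import Data.List.Relation.Unary.AllPairs.Properties as AllPairsₚ
open import Data.Maybe using (Maybe; just; nothing)
open import Data.Nat as ℕ using (ℕ; zero; suc; _<_; _≤_; _!; s≤s; z≤n)
open import Data.Nat.Combinatorics using (_C_; nCn≡1; k![n∸k]!∣n!)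
open import Data.Nat.Combinatorics.Specification using (nCk≡n!/k![n-k]!)
open import Data.Nat.Coprimality using (Coprime; coprime-Bézout)
import Data.Nat.Divisibility as ℕ∣
open import Data.Nat.DivMod using (_/_; _%_; m/n*n≡m; m≡m%n+[m/n]*n; m<n⇒m%n≡m; m<n*o⇒m/o<n)
open import Data.Nat.GCD using (gcd; gcd-GCD; module GCD; module Bézout; gcd[m,n]∣m; gcd[m,n]∣n; gcd[m,n]≡0⇒n≡0)
open import Data.Nat.Induction using (<-rec)
open import Data.Nat.ListAction using (product)
open import Data.Nat.Primality using (Prime; euclidsLemma; ¬prime[1]; prime⇒nonZero; prime⇒irreducible)
open import Data.Nat.Primality.Factorisation using (factorise)
import Data.Nat.Properties as ℕₚ
open import Data.Nat.Properties using (_!*_!≢0)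
import Data.Nat.Solver as ℕ-Solver
import Data.Product as Product
open import Data.Product using (_,_; ∃; proj₁; proj₂)
open import Data.Sign as Sign using ()
open import Data.Sum using (_⊎_; inj₁; inj₂)
open import Data.Vec.Functional using (init)
open import Function using (_∘_)
open import Relation.Binary.Bundles using (Setoid)
open import Relation.Binary.Definitions using (tri<; tri≈; tri>)
open import Relation.Binary.PropositionalEquality as ≡ using (_≡_; cong; cong₂)
import Relation.Binary.Reasoning.Setoid as SetoidReasoning
open import Relation.Nullary using (¬_; yes; no; contradiction)

-- Number theory

prime∤m! : ∀ {p m} → Prime p → m < p → ¬ p ℕ∣.∣ m !
prime∤m! {p} {zero}  p-prime _   p∣1  = ¬prime[1] (≡.subst Prime (ℕ∣.∣1⇒≡1 p∣1) p-prime)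
prime∤m! {p} {suc m} p-prime m<p p∣m! with euclidsLemma (suc m) (m !) p-prime p∣m!
... | inj₁ p∣1+m = ℕₚ.<⇒≱ m<p (ℕ∣.∣⇒≤ p∣1+m)
... | inj₂ p∣m!  = prime∤m! p-prime (ℕₚ.<-trans (ℕₚ.n<1+n m) m<p) p∣m!

prime∣pCk : ∀ {p k} → Prime p → 0 < k → k < p → p ℕ∣.∣ p C k
prime∣pCk {p@(suc q)} {k} p-prime 0<k k<p
  with euclidsLemma (p C k) (k ! ℕ.* (p ℕ.∸ k) !) p-prime p∣pCk*k![p∸k]!
  where
  instance _ = k !* (p ℕ.∸ k) !≢0
  p∣pCk*k![p∸k]! : p ℕ∣.∣ (p C k) ℕ.* (k ! ℕ.* (p ℕ.∸ k) !)
  p∣pCk*k![p∸k]! = ≡.subst (p ℕ∣.∣_)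
    (≡.sym (≡.trans (≡.cong (ℕ._* (k ! ℕ.* (p ℕ.∸ k) !)) (nCk≡n!/k![n-k]! (ℕₚ.<⇒≤ k<p)))
                    (m/n*n≡m (k![n∸k]!∣n! (ℕₚ.<⇒≤ k<p)))))
    (ℕ∣.m∣m*n (q !))
... | inj₁ p∣pCk           = p∣pCk
... | inj₂ p∣k!*[p∸k]! with euclidsLemma (k !) ((p ℕ.∸ k) !) p-prime p∣k!*[p∸k]!
...   | inj₁ p∣k!      = contradiction p∣k! (prime∤m! p-prime k<p)
...   | inj₂ p∣[p∸k]!  = contradiction p∣[p∸k]! (prime∤m! p-prime (ℕₚ.∸-monoʳ-< 0<k (ℕₚ.<⇒≤ k<p)))

prime-cofactor : ∀ {δ n} → 0 < δ → δ < n → δ ℕ∣.∣ n →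
                 ∃ λ t → ∃ λ m → Prime t Product.× n ≡ m ℕ.* t Product.× δ ℕ∣.∣ m
prime-cofactor {δ} {n} 0<δ δ<n (ℕ∣.divides zero n≡0) =
  contradiction n≡0 (ℕₚ.<⇒≢ (ℕₚ.<-trans 0<δ δ<n) ∘ ≡.sym)
prime-cofactor {δ} {n} 0<δ δ<n (ℕ∣.divides 1 n≡δ+0) =
  contradiction (≡.trans n≡δ+0 (ℕₚ.+-identityʳ δ)) (ℕₚ.<⇒≢ δ<n ∘ ≡.sym)
prime-cofactor {δ} {n} 0<δ δ<n (ℕ∣.divides k@(suc (suc _)) n≡kδ) with factorise k
... | record { factors = t ∷ ts ; isFactorisation = k≡t*ts ; factorsPrime = t-prime ∷ _ } =
  t , product ts ℕ.* δ , t-prime , n≡[tsδ]t , ℕ∣.n∣m*n (product ts)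
  where
  open ℕ-Solver.+-*-Solver using (solve; _:=_; _:*_)
  n≡[tsδ]t : n ≡ product ts ℕ.* δ ℕ.* t
  n≡[tsδ]t = ≡.trans n≡kδ (≡.trans (cong (ℕ._* δ) k≡t*ts)
    (solve 3 (λ t P δ → (t :* P) :* δ := (P :* δ) :* t) ≡.refl t (product ts) δ))

module _ (P : ℕ → Set) (P-+ : ∀ a b → P a → P b → P (a ℕ.+ b)) (P-∸ : ∀ a b → P a → P (a ℕ.+ b) → P b) where

  P-multiple : ∀ a k → P a → P (k ℕ.* a)
  P-multiple a zero    Pa = P-∸ a 0 Pa (≡.subst P (≡.sym (ℕₚ.+-identityʳ a)) Pa)
  P-multiple a (suc k) Pa = P-+ a (k ℕ.* a) Pa (P-multiple a k Pa)

  P-gcd : ∀ a b → P a → P b → P (gcd a b)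
  P-gcd a b Pa Pb with Bézout.lemma a b
  ... | Bézout.result d g (Bézout.+- x y d+yb≡xa) = ≡.subst P (GCD.unique g (gcd-GCD a b))
    (P-∸ (y ℕ.* b) d (P-multiple b y Pb) (≡.subst P (≡.trans (≡.sym d+yb≡xa) (ℕₚ.+-comm d (y ℕ.* b))) (P-multiple a x Pa)))
  ... | Bézout.result d g (Bézout.-+ x y d+xa≡yb) = ≡.subst P (GCD.unique g (gcd-GCD a b))
    (P-∸ (x ℕ.* a) d (P-multiple a x Pa) (≡.subst P (≡.trans (≡.sym d+xa≡yb) (ℕₚ.+-comm d (x ℕ.* a))) (P-multiple b y Pb)))

⌊_/2^_⌋ : ℕ → ℕ → ℕ
⌊ m /2^ zero  ⌋ = m
⌊ m /2^ suc j ⌋ = ⌊ m / 2 /2^ j ⌋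

bit≡⌊/2^⌋%2 : ∀ m j → bit m j ≡ ⌊ m /2^ j ⌋ % 2
bit≡⌊/2^⌋%2 m zero    = ≡.refl
bit≡⌊/2^⌋%2 m (suc j) = bit≡⌊/2^⌋%2 (m / 2) j

⌊/2^suc⌋ : ∀ m j → ⌊ m /2^ suc j ⌋ ≡ ⌊ m /2^ j ⌋ / 2
⌊/2^suc⌋ m zero    = ≡.refl
⌊/2^suc⌋ m (suc j) = ⌊/2^suc⌋ (m / 2) j

⌊/2^⌋-step : ∀ m j → ⌊ m /2^ suc j ⌋ ℕ.* 2 ℕ.+ bit m j ≡ ⌊ m /2^ j ⌋
⌊/2^⌋-step m j = begin
  ⌊ m /2^ suc j ⌋ ℕ.* 2 ℕ.+ bit m j          ≡⟨ cong₂ (λ q r → q ℕ.* 2 ℕ.+ r) (⌊/2^suc⌋ m j) (bit≡⌊/2^⌋%2 m j) ⟩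
  ⌊ m /2^ j ⌋ / 2 ℕ.* 2 ℕ.+ ⌊ m /2^ j ⌋ % 2  ≡⟨ ℕₚ.+-comm _ (⌊ m /2^ j ⌋ % 2) ⟩
  ⌊ m /2^ j ⌋ % 2 ℕ.+ ⌊ m /2^ j ⌋ / 2 ℕ.* 2  ≡⟨ m≡m%n+[m/n]*n ⌊ m /2^ j ⌋ 2 ⟨
  ⌊ m /2^ j ⌋                                ∎
  where open ≡.≡-Reasoning

⌊/2^⌋<2 : ∀ m s → m < 2 ℕ.^ suc s → ⌊ m /2^ s ⌋ < 2
⌊/2^⌋<2 m zero    m<2   = m<2
⌊/2^⌋<2 m (suc s) m<2^s =
  ⌊/2^⌋<2 (m / 2) s (m<n*o⇒m/o<n {m} {2 ℕ.^ suc s} {2} (≡.subst (m <_) (ℕₚ.*-comm 2 (2 ℕ.^ suc s)) m<2^s))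

bit≡⌊/2^⌋ : ∀ m s → m < 2 ℕ.^ suc s → bit m s ≡ ⌊ m /2^ s ⌋
bit≡⌊/2^⌋ m s m<2^s = ≡.trans (bit≡⌊/2^⌋%2 m s) (m<n⇒m%n≡m (⌊/2^⌋<2 m s m<2^s))

-- Commutative rings

-- Algebra.Solver.Ring needs coefficients with decidable equality; ℤ maps into every ring.
module ℤ-Coefficients {c ℓ} (R : CommutativeRing c ℓ) where
  open CommutativeRing R
  open RingProperties ring using (-0#≈0#; -‿involutive; -‿distribˡ-*; -‿distribʳ-*; -‿+-comm)
  open SemiringMultProperties semiring using (_×_; ×-homo-+; ×1-homo-*)
  open CommutativeSemigroupProperties +-commutativeSemigroup using (interchange)
  open SetoidReasoning setoid

  fromℤ : ℤ → Carrier
  fromℤ (+ n)    = n × 1#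
  fromℤ -[1+ n ] = - (suc n × 1#)

  private
    fromℤ-⊖ : ∀ m n → fromℤ (m ℤ.⊖ n) ≈ m × 1# - n × 1#
    fromℤ-⊖ m zero = begin
      fromℤ (m ℤ.⊖ 0)    ≡⟨ ≡.cong fromℤ (ℤₚ.⊖-≥ {m} {0} ℕ.z≤n) ⟩
      m × 1#             ≈⟨ +-identityʳ _ ⟨
      m × 1# + 0#        ≈⟨ +-congˡ -0#≈0# ⟨
      m × 1# - 0#        ∎
    fromℤ-⊖ zero (suc n) = begin
      fromℤ (0 ℤ.⊖ suc n) ≡⟨ ≡.cong fromℤ (ℤₚ.⊖-< {0} {suc n} ℕ.z<s) ⟩
      - (suc n × 1#)      ≈⟨ +-identityˡ _ ⟨
      0# - suc n × 1#     ∎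
    fromℤ-⊖ (suc m) (suc n) = begin
      fromℤ (suc m ℤ.⊖ suc n)                     ≡⟨ ≡.cong fromℤ (ℤₚ.[1+m]⊖[1+n]≡m⊖n m n) ⟩
      fromℤ (m ℤ.⊖ n)                             ≈⟨ fromℤ-⊖ m n ⟩
      m × 1# - n × 1#                             ≈⟨ +-identityˡ _ ⟨
      0# + (m × 1# - n × 1#)                      ≈⟨ +-congʳ (-‿inverseʳ 1#) ⟨
      (1# - 1#) + (m × 1# - n × 1#)               ≈⟨ interchange 1# (- 1#) _ _ ⟩
      (1# + m × 1#) + (- 1# - n × 1#)             ≈⟨ +-congˡ (-‿+-comm 1# _) ⟩
      (1# + m × 1#) - (1# + n × 1#)               ∎

    fromℤ-pos◃ : ∀ n → fromℤ (Sign.+ ℤ.◃ n) ≈ n × 1#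
    fromℤ-pos◃ zero    = refl
    fromℤ-pos◃ (suc n) = refl

    fromℤ-neg◃ : ∀ n → fromℤ (Sign.- ℤ.◃ n) ≈ - (n × 1#)
    fromℤ-neg◃ zero    = sym -0#≈0#
    fromℤ-neg◃ (suc n) = refl

  fromℤ-homo-+ : ∀ i j → fromℤ (i ℤ.+ j) ≈ fromℤ i + fromℤ j
  fromℤ-homo-+ (+ m)    (+ n)    = ×-homo-+ 1# m n
  fromℤ-homo-+ (+ m)    -[1+ n ] = fromℤ-⊖ m (suc n)
  fromℤ-homo-+ -[1+ m ] (+ n)    = trans (fromℤ-⊖ n (suc m)) (+-comm _ _)
  fromℤ-homo-+ -[1+ m ] -[1+ n ] = begin
    - (suc (suc (m ℕ.+ n)) × 1#)              ≡⟨ ≡.cong (λ k → - (k × 1#)) (ℕₚ.+-suc (suc m) n) ⟨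
    - ((suc m ℕ.+ suc n) × 1#)                ≈⟨ -‿cong (×-homo-+ 1# (suc m) (suc n)) ⟩
    - (suc m × 1# + suc n × 1#)               ≈⟨ -‿+-comm _ _ ⟨
    - (suc m × 1#) - suc n × 1#               ∎

  fromℤ-homo-* : ∀ i j → fromℤ (i ℤ.* j) ≈ fromℤ i * fromℤ j
  fromℤ-homo-* (+ m)    (+ n)    = trans (fromℤ-pos◃ (m ℕ.* n)) (×1-homo-* m n)
  fromℤ-homo-* (+ m)    -[1+ n ] = begin
    fromℤ (Sign.- ℤ.◃ (m ℕ.* suc n))    ≈⟨ fromℤ-neg◃ (m ℕ.* suc n) ⟩
    - ((m ℕ.* suc n) × 1#)              ≈⟨ -‿cong (×1-homo-* m (suc n)) ⟩
    - (m × 1# * suc n × 1#)             ≈⟨ -‿distribʳ-* _ _ ⟩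
    m × 1# * - (suc n × 1#)             ∎
  fromℤ-homo-* -[1+ m ] (+ n)    = begin
    fromℤ (Sign.- ℤ.◃ (suc m ℕ.* n))    ≈⟨ fromℤ-neg◃ (suc m ℕ.* n) ⟩
    - ((suc m ℕ.* n) × 1#)              ≈⟨ -‿cong (×1-homo-* (suc m) n) ⟩
    - (suc m × 1# * n × 1#)             ≈⟨ -‿distribˡ-* _ _ ⟩
    - (suc m × 1#) * n × 1#             ∎
  fromℤ-homo-* -[1+ m ] -[1+ n ] = begin
    fromℤ (Sign.+ ℤ.◃ (suc m ℕ.* suc n))   ≈⟨ fromℤ-pos◃ (suc m ℕ.* suc n) ⟩
    (suc m ℕ.* suc n) × 1#                 ≈⟨ ×1-homo-* (suc m) (suc n) ⟩
    suc m × 1# * suc n × 1#                ≈⟨ -‿involutive _ ⟨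
    - - (suc m × 1# * suc n × 1#)          ≈⟨ -‿cong (-‿distribˡ-* _ _) ⟩
    - (- (suc m × 1#) * suc n × 1#)        ≈⟨ -‿distribʳ-* _ _ ⟩
    - (suc m × 1#) * - (suc n × 1#)        ∎

  fromℤ-homo-‿ : ∀ i → fromℤ (ℤ.- i) ≈ - fromℤ i
  fromℤ-homo-‿ (+ zero)  = sym -0#≈0#
  fromℤ-homo-‿ (+ suc n) = refl
  fromℤ-homo-‿ -[1+ n ]  = sym (-‿involutive _)

  fromℤ-morphism : ℤ.+-*-rawRing -Raw-AlmostCommutative⟶ fromCommutativeRing R
  fromℤ-morphism = record
    { ⟦_⟧ = fromℤ ; +-homo = fromℤ-homo-+ ; *-homo = fromℤ-homo-* ; -‿homo = fromℤ-homo-‿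
    ; 0-homo = refl ; 1-homo = +-identityʳ 1# }

  fromℤ-≟ : ∀ i j → Maybe (fromℤ i ≈ fromℤ j)
  fromℤ-≟ i j with i ℤ.≟ j
  ... | yes ≡.refl = just refl
  ... | no _       = nothing

  open Algebra.Solver.Ring ℤ.+-*-rawRing (fromCommutativeRing R) fromℤ-morphism fromℤ-≟ public

module Quotient {c ℓ} (R : CommutativeRing c ℓ) where
  open CommutativeRing R
  open ℤ-Coefficients R using (solve; _:=_; _:+_; _:*_; :-_; _:-_; con)

  infix 4 _≈_[mod_]
  record _≈_[mod_] (x y g : Carrier) : Set (c ⊔ ℓ) where
    constructor mkMod
    field
      quotient : Carrier
      equality : x - y ≈ g * quotient
  open _≈_[mod_] public

  module _ {g : Carrier} where

    ≈⇒≈[mod] : ∀ {x y} → x ≈ y → x ≈ y [mod g ]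
    ≈⇒≈[mod] {x} {y} x≈y = mkMod 0# (begin
      x - y   ≈⟨ +-congʳ x≈y ⟩
      y - y   ≈⟨ -‿inverseʳ y ⟩
      0#      ≈⟨ zeroʳ g ⟨
      g * 0#  ∎)
      where open SetoidReasoning setoid

    [mod]-sym : ∀ {x y} → x ≈ y [mod g ] → y ≈ x [mod g ]
    [mod]-sym {x} {y} (mkMod q eq) = mkMod (- q) (trans
      (solve 2 (λ x y → y :- x := :- (x :- y)) refl x y)
      (trans (-‿cong eq) (solve 2 (λ g q → :- (g :* q) := g :* (:- q)) refl g q)))

    [mod]-trans : ∀ {x y z} → x ≈ y [mod g ] → y ≈ z [mod g ] → x ≈ z [mod g ]
    [mod]-trans {x} {y} {z} (mkMod q eq) (mkMod q' eq') = mkMod (q + q') (trans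
      (solve 3 (λ x y z → x :- z := (x :- y) :+ (y :- z)) refl x y z)
      (trans (+-cong eq eq') (sym (distribˡ g q q'))))

    [mod]-+-cong : ∀ {x x' y y'} → x ≈ x' [mod g ] → y ≈ y' [mod g ] → x + y ≈ x' + y' [mod g ]
    [mod]-+-cong {x} {x'} {y} {y'} (mkMod q eq) (mkMod q' eq') = mkMod (q + q') (trans
      (solve 4 (λ x y x' y' → (x :+ y) :- (x' :+ y') := (x :- x') :+ (y :- y')) refl x y x' y')
      (trans (+-cong eq eq') (sym (distribˡ g q q'))))

    [mod]-neg-cong : ∀ {x x'} → x ≈ x' [mod g ] → - x ≈ - x' [mod g ]
    [mod]-neg-cong {x} {x'} (mkMod q eq) = mkMod (- q) (trans
      (solve 2 (λ x x' → (:- x) :- (:- x') := :- (x :- x')) refl x x')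
      (trans (-‿cong eq) (solve 2 (λ g q → :- (g :* q) := g :* (:- q)) refl g q)))

    [mod]-*-cong : ∀ {x x' y y'} → x ≈ x' [mod g ] → y ≈ y' [mod g ] → x * y ≈ x' * y' [mod g ]
    [mod]-*-cong {x} {x'} {y} {y'} (mkMod q eq) (mkMod q' eq') = mkMod (x * q' + q * y') (trans
      (solve 4 (λ x y x' y' → x :* y :- x' :* y' := x :* (y :- y') :+ (x :- x') :* y') refl x y x' y')
      (trans (+-cong (*-congˡ eq') (*-congʳ eq))
        (solve 5 (λ g x q y' q' → x :* (g :* q') :+ (g :* q) :* y' := g :* (x :* q' :+ q :* y')) refl g x q y' q')))

    ≈q*g+r⇒≈r[mod] : ∀ {x q r} → x ≈ q * g + r → x ≈ r [mod g ]
    ≈q*g+r⇒≈r[mod] {x} {q} {r} x≈qg+r = mkMod q (trans (+-congʳ x≈qg+r)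
      (solve 3 (λ q g r → (q :* g :+ r) :- r := g :* q) refl q g r))

    [mod]-divisor : ∀ {f x y} → (∃ λ c → f ≈ g * c) → x ≈ y [mod f ] → x ≈ y [mod g ]
    [mod]-divisor {f} (c , f≈gc) (mkMod q eq) = mkMod (c * q) (trans eq (trans (*-congʳ f≈gc) (*-assoc g c q)))

    g≈0[mod] : g ≈ 0# [mod g ]
    g≈0[mod] = mkMod 1# (trans (solve 1 (λ g → g :- con (+ 0) := g) refl g) (sym (*-identityʳ g)))

    [mod]-inverse : ∀ {a b w} → a * g + b * w ≈ 1# → b * w ≈ 1# [mod g ]
    [mod]-inverse {a} {b} {w} ag+bw≈1 = mkMod (- a) (trans (+-congˡ (-‿cong (sym ag+bw≈1)))
      (solve 4 (λ a g b w → b :* w :- (a :* g :+ b :* w) := g :* (:- a)) refl a g b w))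

  quotientRing : Carrier → CommutativeRing c (c ⊔ ℓ)
  quotientRing g = record
    { Carrier = Carrier ; _≈_ = _≈_[mod g ] ; _+_ = _+_ ; _*_ = _*_ ; -_ = -_ ; 0# = 0# ; 1# = 1#
    ; isCommutativeRing = record
      { isRing = record
        { +-isAbelianGroup = record
          { isGroup = record
            { isMonoid = record
              { isSemigroup = record
                { isMagma = record
                  { isEquivalence = record { refl = ≈⇒≈[mod] refl ; sym = [mod]-sym ; trans = [mod]-trans }
                  ; ∙-cong = [mod]-+-cong }
                ; assoc = λ x y z → ≈⇒≈[mod] (+-assoc x y z) }
              ; identity = (λ x → ≈⇒≈[mod] (+-identityˡ x)) , (λ x → ≈⇒≈[mod] (+-identityʳ x)) }
            ; inverse = (λ x → ≈⇒≈[mod] (-‿inverseˡ x)) , (λ x → ≈⇒≈[mod] (-‿inverseʳ x))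
            ; ⁻¹-cong = [mod]-neg-cong }
          ; comm = λ x y → ≈⇒≈[mod] (+-comm x y) }
        ; *-cong = [mod]-*-cong
        ; *-assoc = λ x y z → ≈⇒≈[mod] (*-assoc x y z)
        ; *-identity = (λ x → ≈⇒≈[mod] (*-identityˡ x)) , (λ x → ≈⇒≈[mod] (*-identityʳ x))
        ; distrib = (λ x y z → ≈⇒≈[mod] (distribˡ x y z)) , (λ x y z → ≈⇒≈[mod] (distribʳ x y z)) }
      ; *-comm = λ x y → ≈⇒≈[mod] (*-comm x y) } }

module Roots {c ℓ} (R : CommutativeRing c ℓ) where
  open CommutativeRing R
  open ℤ-Coefficients R using (solve; _:=_; _:+_; _:*_; _:-_)
  open SetoidReasoning setoid

  eval : List Carrier → Carrier → Carrier
  eval []       x = 0#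
  eval (a ∷ cs) x = a + x * eval cs x

  eval-cong : ∀ cs {x y} → x ≈ y → eval cs x ≈ eval cs y
  eval-cong []       x≈y = refl
  eval-cong (a ∷ cs) x≈y = +-congˡ (*-cong x≈y (eval-cong cs x≈y))

  eval-[a] : ∀ a x → eval (a ∷ []) x ≈ a
  eval-[a] a x = trans (+-congˡ (zeroʳ x)) (+-identityʳ a)

  LeadingNonzero : Carrier → List Carrier → Set ℓ
  LeadingNonzero a []       = ¬ a ≈ 0#
  LeadingNonzero a (b ∷ cs) = LeadingNonzero b cs

  -- The constructive form of a * b ≈ 0# → a ≈ 0# ⊎ b ≈ 0#.  It needs no decidable ≈, which is
  -- why root-bound only asks its roots to be roots up to ¬ ¬.
  NoZeroDivisors : Set (c ⊔ ℓ)
  NoZeroDivisors = ∀ {a b} → a * b ≈ 0# → ¬ a ≈ 0# → ¬ b ≈ 0# → ⊥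

  deflate : Carrier → Carrier → List Carrier → List Carrier
  deflate r a []       = []
  deflate r a (b ∷ cs) = eval (b ∷ cs) r ∷ deflate r b cs

  deflate-length : ∀ r a cs → length (deflate r a cs) ≡ length cs
  deflate-length r a []       = ≡.refl
  deflate-length r a (b ∷ cs) = ≡.cong suc (deflate-length r b cs)

  deflate-leading : ∀ r a cs → LeadingNonzero a cs → LeadingNonzero (eval (a ∷ cs) r) (deflate r a cs)
  deflate-leading r a []       a≉0 = λ eval≈0 → a≉0 (trans (sym (eval-[a] a r)) eval≈0)
  deflate-leading r a (b ∷ cs) lead = deflate-leading r b cs lead

  factor-theorem : ∀ r a cs x → eval (a ∷ cs) x ≈ (x - r) * eval (deflate r a cs) x + eval (a ∷ cs) r
  factor-theorem r a []       x = begin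
    a + x * 0#                 ≈⟨ eval-[a] a x ⟩
    a                          ≈⟨ eval-[a] a r ⟨
    a + r * 0#                 ≈⟨ +-identityˡ _ ⟨
    0# + (a + r * 0#)          ≈⟨ +-congʳ (zeroʳ (x - r)) ⟨
    (x - r) * 0# + (a + r * 0#) ∎
  factor-theorem r a (b ∷ cs) x = begin
    a + x * eval (b ∷ cs) x
      ≈⟨ +-congˡ (*-congˡ (factor-theorem r b cs x)) ⟩
    a + x * ((x - r) * eval (deflate r b cs) x + eval (b ∷ cs) r)
      ≈⟨ solve 5 (λ a x r q e → a :+ x :* ((x :- r) :* q :+ e) := (x :- r) :* (e :+ x :* q) :+ (a :+ r :* e))
               refl a x r (eval (deflate r b cs) x) (eval (b ∷ cs) r) ⟩
    (x - r) * (eval (b ∷ cs) r + x * eval (deflate r b cs) x) + (a + r * eval (b ∷ cs) r) ∎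

  root-bound : NoZeroDivisors → ∀ a cs → LeadingNonzero a cs →
               ∀ rs → AllPairs (λ r s → ¬ r ≈ s) rs → All (λ r → ¬ ¬ eval (a ∷ cs) r ≈ 0#) rs →
               length rs ≤ length cs
  root-bound domain a cs       lead []       _                 _                = z≤n
  root-bound domain a []       a≉0  (r ∷ rs) _                 (root ∷ _)       =
    ⊥-elim (root λ eval≈0 → a≉0 (trans (sym (eval-[a] a r)) eval≈0))
  root-bound domain a (b ∷ cs) lead (r ∷ rs) (r≉rs ∷ distinct) (root ∷ roots) =
    s≤s (≡.subst (length rs ≤_) (deflate-length r b cs)
      (root-bound domain (eval (b ∷ cs) r) (deflate r b cs) (deflate-leading r b cs lead)
        rs distinct (All.zipWith (λ (r≉s , root-s) → deflate-root r≉s root-s) (r≉rs , roots))))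
    where
    deflate-root : ∀ {s} → ¬ r ≈ s → ¬ ¬ eval (a ∷ b ∷ cs) s ≈ 0# → ¬ ¬ eval (deflate r a (b ∷ cs)) s ≈ 0#
    deflate-root {s} r≉s root-s q≉0 = root λ eval-r≈0 → root-s λ eval-s≈0 →
      domain (begin
        (s - r) * eval (deflate r a (b ∷ cs)) s
          ≈⟨ +-identityʳ _ ⟨
        (s - r) * eval (deflate r a (b ∷ cs)) s + 0#
          ≈⟨ +-congˡ eval-r≈0 ⟨
        (s - r) * eval (deflate r a (b ∷ cs)) s + eval (a ∷ b ∷ cs) r
          ≈⟨ factor-theorem r a (b ∷ cs) s ⟨
        eval (a ∷ b ∷ cs) s
          ≈⟨ eval-s≈0 ⟩
        0# ∎)
        (λ s-r≈0 → r≉s (sym (trans (solve 2 (λ s r → s := (s :- r) :+ r) refl s r)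
                                   (trans (+-congʳ s-r≈0) (+-identityˡ r)))))
        q≉0

module Frobenius {c ℓ} (R : CommutativeRing c ℓ) where
  open CommutativeRing R
  open RingProperties ring using (-‿involutive; +-inverseˡ-unique)
  open SemiringMultProperties semiring using (_×_; ×-homo-1; ×-congʳ; ×-assoc-*; ×1-homo-*)
  open SemiringExpProperties semiring using (_^_; ^-congˡ; ^-assocʳ)
  open BinomialTheorem commutativeSemiring using (theorem; binomialTerm)
  open MonoidSumProperties +-monoid using (sum; sum-init-last; sum-cong-≋; sum-replicate-zero)
  open CommutativeSemiringExpProperties commutativeSemiring using (^-distrib-*)
  open ℤ-Coefficients R using (fromℤ)
  open Roots R using (eval; eval-cong)
  open SetoidReasoning setoid

  binomial-collapse : ∀ n .{{_ : ℕ.NonZero n}} → (∀ k → 0 < k → k < n → ∀ z → (n C k) × z ≈ 0#) →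
                      ∀ x y → (x + y) ^ n ≈ x ^ n + y ^ n
  binomial-collapse n@(suc m) inner≈0 x y = begin
    (x + y) ^ n                                    ≈⟨ theorem n x y ⟩
    t Fin.zero + sum (t ∘ Fin.suc)                 ≈⟨ +-congˡ (sum-init-last (t ∘ Fin.suc)) ⟩
    t Fin.zero + (sum (init (t ∘ Fin.suc)) + t (Fin.suc (fromℕ m)))
      ≈⟨ +-cong first (+-cong (trans (sum-cong-≋ inner) (sum-replicate-zero m)) last) ⟩
    y ^ n + (0# + x ^ n)                           ≈⟨ +-congˡ (+-identityˡ _) ⟩
    y ^ n + x ^ n                                  ≈⟨ +-comm _ _ ⟩
    x ^ n + y ^ n                                  ∎
    where
    t = binomialTerm x y n
    first : t Fin.zero ≈ y ^ n
    first = trans (×-homo-1 _) (*-identityˡ _)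
    last : t (fromℕ n) ≈ x ^ n
    last = begin
      (n C toℕ (fromℕ n)) × (x ^ toℕ (fromℕ n) * y ^ (n ℕ.∸ toℕ (fromℕ n)))
        ≡⟨ ≡.cong (λ k → (n C k) × (x ^ k * y ^ (n ℕ.∸ k))) (Finₚ.toℕ-fromℕ n) ⟩
      (n C n) × (x ^ n * y ^ (n ℕ.∸ n))
        ≡⟨ ≡.cong₂ (λ c e → c × (x ^ n * y ^ e)) (nCn≡1 n) (ℕₚ.n∸n≡0 n) ⟩
      1 × (x ^ n * 1#)                             ≈⟨ ×-homo-1 _ ⟩
      x ^ n * 1#                                   ≈⟨ *-identityʳ _ ⟩
      x ^ n                                        ∎
    inner : ∀ i → t (Fin.suc (inject₁ i)) ≈ 0#
    inner i = inner≈0 (suc (toℕ (inject₁ i))) (s≤s z≤n)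
      (s≤s (≡.subst (_< m) (≡.sym (Finₚ.toℕ-inject₁ i)) (Finₚ.toℕ<n i))) _

  1#^n≈1# : ∀ n → 1# ^ n ≈ 1#
  1#^n≈1# zero    = refl
  1#^n≈1# (suc n) = trans (*-identityˡ _) (1#^n≈1# n)

  0#^n≈0# : ∀ n .{{_ : ℕ.NonZero n}} → 0# ^ n ≈ 0#
  0#^n≈0# (suc n) = zeroˡ _

  n×x≈[n×1]*x : ∀ n x → n × x ≈ (n × 1#) * x
  n×x≈[n×1]*x n x = trans (×-congʳ n (sym (*-identityˡ x))) (sym (×-assoc-* n 1# x))

  module CharacteristicP {p} (p-prime : Prime p) (char-p : p × 1# ≈ 0#) where
    private instance
      p≢0 = prime⇒nonZero p-prime

    inner-binomial≈0 : ∀ k → 0 < k → k < p → ∀ z → (p C k) × z ≈ 0#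
    inner-binomial≈0 k 0<k k<p z with prime∣pCk p-prime 0<k k<p
    ... | ℕ∣.divides q pCk≡q*p = begin
      (p C k) × z                  ≈⟨ n×x≈[n×1]*x (p C k) z ⟩
      ((p C k) × 1#) * z           ≡⟨ ≡.cong (λ n → (n × 1#) * z) pCk≡q*p ⟩
      ((q ℕ.* p) × 1#) * z         ≈⟨ *-congʳ (×1-homo-* q p) ⟩
      ((q × 1#) * (p × 1#)) * z    ≈⟨ *-congʳ (*-congˡ char-p) ⟩
      ((q × 1#) * 0#) * z          ≈⟨ *-congʳ (zeroʳ _) ⟩
      0# * z                       ≈⟨ zeroˡ z ⟩
      0#                           ∎

    frobenius-+ : ∀ x y → (x + y) ^ p ≈ x ^ p + y ^ p
    frobenius-+ = binomial-collapse p inner-binomial≈0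

    frobenius-‿ : ∀ x → (- x) ^ p ≈ - (x ^ p)
    frobenius-‿ x = +-inverseˡ-unique ((- x) ^ p) (x ^ p) (begin
      (- x) ^ p + x ^ p  ≈⟨ frobenius-+ (- x) x ⟨
      (- x + x) ^ p      ≈⟨ ^-congˡ p (-‿inverseˡ x) ⟩
      0# ^ p             ≈⟨ 0#^n≈0# p ⟩
      0#                 ∎)

    fermat-× : ∀ n → (n × 1#) ^ p ≈ n × 1#
    fermat-× zero    = 0#^n≈0# p
    fermat-× (suc n) = trans (frobenius-+ 1# (n × 1#)) (+-cong (1#^n≈1# p) (fermat-× n))

    fermat : ∀ z → fromℤ z ^ p ≈ fromℤ z
    fermat (+ n)    = fermat-× n
    fermat -[1+ n ] = trans (frobenius-‿ (suc n × 1#)) (-‿cong (fermat-× (suc n)))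

    eval-frobenius : ∀ cs x → All (λ c → c ^ p ≈ c) cs → eval cs (x ^ p) ≈ eval cs x ^ p
    eval-frobenius []       x []              = sym (0#^n≈0# p)
    eval-frobenius (c ∷ cs) x (c^p≈c ∷ fixed) = begin
      c + x ^ p * eval cs (x ^ p)      ≈⟨ +-cong (sym c^p≈c) (*-congˡ (eval-frobenius cs x fixed)) ⟩
      c ^ p + x ^ p * eval cs x ^ p    ≈⟨ +-congˡ (^-distrib-* x (eval cs x) p) ⟨
      c ^ p + (x * eval cs x) ^ p      ≈⟨ frobenius-+ c _ ⟨
      (c + x * eval cs x) ^ p          ∎

    eval-frobenius-^ : ∀ cs x i → All (λ c → c ^ p ≈ c) cs → eval cs (x ^ (p ℕ.^ i)) ≈ eval cs x ^ (p ℕ.^ i)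
    eval-frobenius-^ cs x zero    fixed = trans (eval-cong cs (*-identityʳ x)) (sym (*-identityʳ _))
    eval-frobenius-^ cs x (suc i) fixed = begin
      eval cs (x ^ (p ℕ.* p ℕ.^ i))       ≈⟨ eval-cong cs (^-assocʳ x p (p ℕ.^ i)) ⟨
      eval cs ((x ^ p) ^ (p ℕ.^ i))       ≈⟨ eval-frobenius-^ cs (x ^ p) i fixed ⟩
      eval cs (x ^ p) ^ (p ℕ.^ i)         ≈⟨ ^-congˡ (p ℕ.^ i) (eval-frobenius cs x fixed) ⟩
      (eval cs x ^ p) ^ (p ℕ.^ i)         ≈⟨ ^-assocʳ (eval cs x) p (p ℕ.^ i) ⟩
      eval cs x ^ (p ℕ.* p ℕ.^ i)         ∎

module SquareAndMultiply {c ℓ} (R : CommutativeRing c ℓ) where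
  open CommutativeRing R
  open SemiringExpProperties semiring using (_^_; ^-congˡ; ^-assocʳ; ^-homo-*)
  open SetoidReasoning setoid

  square-and-multiply : ∀ m s x (y : ℕ → Carrier) → m < 2 ℕ.^ suc s →
    y s ≈ x ^ bit m s → (∀ j → j < s → y j ≈ y (suc j) ^ 2 * x ^ bit m j) → y 0 ≈ x ^ m
  square-and-multiply m s x y m<2^s top step = y≈x^⌊/2^⌋ s 0 (ℕₚ.+-identityʳ s)
    where
    y≈x^⌊/2^⌋ : ∀ d j → d ℕ.+ j ≡ s → y j ≈ x ^ ⌊ m /2^ j ⌋
    y≈x^⌊/2^⌋ zero    j ≡.refl = trans top (reflexive (≡.cong (x ^_) (bit≡⌊/2^⌋ m j m<2^s)))
    y≈x^⌊/2^⌋ (suc d) j d+j≡s = begin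
      y j                                           ≈⟨ step j (≡.subst (j <_) d+j≡s (ℕₚ.m<n+m j (s≤s z≤n))) ⟩
      y (suc j) ^ 2 * x ^ bit m j                      ≈⟨ *-congʳ (^-congˡ 2 (y≈x^⌊/2^⌋ d (suc j) (≡.trans (ℕₚ.+-suc d j) d+j≡s))) ⟩
      (x ^ ⌊ m /2^ suc j ⌋) ^ 2 * x ^ bit m j         ≈⟨ *-congʳ (^-assocʳ x ⌊ m /2^ suc j ⌋ 2) ⟩
      x ^ (⌊ m /2^ suc j ⌋ ℕ.* 2) * x ^ bit m j          ≈⟨ ^-homo-* x (⌊ m /2^ suc j ⌋ ℕ.* 2) (bit m j) ⟨
      x ^ (⌊ m /2^ suc j ⌋ ℕ.* 2 ℕ.+ bit m j)               ≡⟨ ≡.cong (x ^_) (⌊/2^⌋-step m j) ⟩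
      x ^ ⌊ m /2^ j ⌋                                   ∎

-- Integer polynomials and polynomials over 𝔽ₚ

-- Equality in ℤ[X]: coefficient lists differing by trailing zeros are equal.
infix 4 _≐_
record _≐_ (f g : Poly) : Set where
  constructor mk≐
  field coeff-≡ : ∀ k → coeff f k ≡ coeff g k
open _≐_ public

coeff-+P : ∀ f g k → coeff (f +P g) k ≡ coeff f k ℤ.+ coeff g k
coeff-+P []      g       k       = ≡.sym (ℤₚ.+-identityˡ _)
coeff-+P (a ∷ f) []      k       = ≡.sym (ℤₚ.+-identityʳ _)
coeff-+P (a ∷ f) (b ∷ g) zero    = ≡.refl
coeff-+P (a ∷ f) (b ∷ g) (suc k) = coeff-+P f g k

coeff-negP : ∀ f k → coeff (-P f) k ≡ ℤ.- coeff f k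
coeff-negP []      k       = ≡.refl
coeff-negP (a ∷ f) zero    = ≡.refl
coeff-negP (a ∷ f) (suc k) = coeff-negP f k

coeff-·P : ∀ c f k → coeff (c ·P f) k ≡ c ℤ.* coeff f k
coeff-·P c []      k       = ≡.sym (ℤₚ.*-zeroʳ c)
coeff-·P c (a ∷ f) zero    = ≡.refl
coeff-·P c (a ∷ f) (suc k) = coeff-·P c f k

coeff-subP : ∀ f g k → coeff (f -P g) k ≡ coeff f k ℤ.- coeff g k
coeff-subP f g k = ≡.trans (coeff-+P f (-P g) k) (cong (ℤ._+_ (coeff f k)) (coeff-negP g k))

coeff-*P-zero : ∀ a f g → coeff ((a ∷ f) *P g) 0 ≡ a ℤ.* coeff g 0
coeff-*P-zero a f g = begin
  coeff ((a ∷ f) *P g) 0   ≡⟨ coeff-+P (a ·P g) (+ 0 ∷ f *P g) 0 ⟩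
  coeff (a ·P g) 0 ℤ.+ + 0 ≡⟨ ℤₚ.+-identityʳ _ ⟩
  coeff (a ·P g) 0         ≡⟨ coeff-·P a g 0 ⟩
  a ℤ.* coeff g 0          ∎
  where open ≡.≡-Reasoning

coeff-*P-suc : ∀ a f g k → coeff ((a ∷ f) *P g) (suc k) ≡ a ℤ.* coeff g (suc k) ℤ.+ coeff (f *P g) k
coeff-*P-suc a f g k = ≡.trans (coeff-+P (a ·P g) (+ 0 ∷ f *P g) (suc k)) (cong (ℤ._+ coeff (f *P g) k) (coeff-·P a g (suc k)))

≐-refl : ∀ {f} → f ≐ f
≐-refl = mk≐ λ _ → ≡.refl

≐-sym : ∀ {f g} → f ≐ g → g ≐ f
≐-sym f≐g = mk≐ λ k → ≡.sym (coeff-≡ f≐g k)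

≐-trans : ∀ {f g h} → f ≐ g → g ≐ h → f ≐ h
≐-trans f≐g g≐h = mk≐ λ k → ≡.trans (coeff-≡ f≐g k) (coeff-≡ g≐h k)

≐-setoid : Setoid _ _
≐-setoid = record
  { Carrier = Poly ; _≈_ = _≐_
  ; isEquivalence = record { refl = ≐-refl ; sym = ≐-sym ; trans = ≐-trans } }

module ≐-Reasoning = SetoidReasoning ≐-setoid

∷-cong : ∀ {a b f g} → a ≡ b → f ≐ g → a ∷ f ≐ b ∷ g
∷-cong a≡b f≐g = mk≐ λ { zero → a≡b ; (suc k) → coeff-≡ f≐g k }

0∷[]≐[] : + 0 ∷ [] ≐ []
0∷[]≐[] = mk≐ λ { zero → ≡.refl ; (suc k) → ≡.refl }

+P-cong : ∀ {f f' g g'} → f ≐ f' → g ≐ g' → f +P g ≐ f' +P g'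
+P-cong {f} {f'} {g} {g'} f≐f' g≐g' = mk≐ λ k → begin
  coeff (f +P g) k          ≡⟨ coeff-+P f g k ⟩
  coeff f k ℤ.+ coeff g k   ≡⟨ cong₂ ℤ._+_ (coeff-≡ f≐f' k) (coeff-≡ g≐g' k) ⟩
  coeff f' k ℤ.+ coeff g' k ≡⟨ coeff-+P f' g' k ⟨
  coeff (f' +P g') k        ∎
  where open ≡.≡-Reasoning

+P-congˡ : ∀ f {g g'} → g ≐ g' → f +P g ≐ f +P g'
+P-congˡ f = +P-cong (≐-refl {f})

-P-cong : ∀ {f g} → f ≐ g → -P f ≐ -P g
-P-cong {f} {g} f≐g = mk≐ λ k →
  ≡.trans (coeff-negP f k) (≡.trans (cong ℤ.-_ (coeff-≡ f≐g k)) (≡.sym (coeff-negP g k)))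

+P-comm : ∀ f g → f +P g ≐ g +P f
+P-comm f g = mk≐ λ k →
  ≡.trans (coeff-+P f g k) (≡.trans (ℤₚ.+-comm (coeff f k) _) (≡.sym (coeff-+P g f k)))

+P-assoc : ∀ f g h → (f +P g) +P h ≐ f +P (g +P h)
+P-assoc f g h = mk≐ λ k → begin
  coeff ((f +P g) +P h) k                   ≡⟨ coeff-+P (f +P g) h k ⟩
  coeff (f +P g) k ℤ.+ coeff h k            ≡⟨ cong (ℤ._+ coeff h k) (coeff-+P f g k) ⟩
  (coeff f k ℤ.+ coeff g k) ℤ.+ coeff h k   ≡⟨ ℤₚ.+-assoc (coeff f k) _ _ ⟩
  coeff f k ℤ.+ (coeff g k ℤ.+ coeff h k)   ≡⟨ cong (ℤ._+_ (coeff f k)) (coeff-+P g h k) ⟨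
  coeff f k ℤ.+ coeff (g +P h) k            ≡⟨ coeff-+P f (g +P h) k ⟨
  coeff (f +P (g +P h)) k                   ∎
  where open ≡.≡-Reasoning

+P-identityʳ : ∀ f → f +P [] ≐ f
+P-identityʳ f = mk≐ λ k → ≡.trans (coeff-+P f [] k) (ℤₚ.+-identityʳ (coeff f k))

+P-inverseʳ : ∀ f → f +P (-P f) ≐ []
+P-inverseʳ f = mk≐ λ k → ≡.trans (coeff-subP f f k) (ℤₚ.+-inverseʳ (coeff f k))

+P-abelianGroup : AbelianGroup _ _
+P-abelianGroup = record
  { Carrier = Poly ; _≈_ = _≐_ ; _∙_ = _+P_ ; ε = [] ; _⁻¹ = -P_
  ; isAbelianGroup = record
    { isGroup = record
      { isMonoid = record
        { isSemigroup = record
          { isMagma = record { isEquivalence = Setoid.isEquivalence ≐-setoid ; ∙-cong = +P-cong }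
          ; assoc = +P-assoc }
        ; identity = (λ _ → ≐-refl) , +P-identityʳ }
      ; inverse = (λ f → ≐-trans (+P-comm (-P f) f) (+P-inverseʳ f)) , +P-inverseʳ
      ; ⁻¹-cong = -P-cong }
    ; comm = +P-comm } }

module +P where
  open AbelianGroup +P-abelianGroup public using (assoc)
  open AbelianGroupProperties +P-abelianGroup public using (⁻¹-∙-comm; xyx⁻¹≈y)
  open CommutativeSemigroupProperties (AbelianGroup.commutativeSemigroup +P-abelianGroup) public
    using (interchange; x∙yz≈y∙xz)

·P-distribʳ : ∀ a b g → (a ℤ.+ b) ·P g ≐ a ·P g +P b ·P g
·P-distribʳ a b g = mk≐ λ k → begin
  coeff ((a ℤ.+ b) ·P g) k                  ≡⟨ coeff-·P (a ℤ.+ b) g k ⟩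
  (a ℤ.+ b) ℤ.* coeff g k                   ≡⟨ ℤₚ.*-distribʳ-+ (coeff g k) a b ⟩
  a ℤ.* coeff g k ℤ.+ b ℤ.* coeff g k       ≡⟨ cong₂ ℤ._+_ (coeff-·P a g k) (coeff-·P b g k) ⟨
  coeff (a ·P g) k ℤ.+ coeff (b ·P g) k     ≡⟨ coeff-+P (a ·P g) (b ·P g) k ⟨
  coeff (a ·P g +P b ·P g) k                ∎
  where open ≡.≡-Reasoning

·P-distribˡ : ∀ c f g → c ·P (f +P g) ≐ c ·P f +P c ·P g
·P-distribˡ c f g = mk≐ λ k → begin
  coeff (c ·P (f +P g)) k                   ≡⟨ coeff-·P c (f +P g) k ⟩
  c ℤ.* coeff (f +P g) k                    ≡⟨ cong (c ℤ.*_) (coeff-+P f g k) ⟩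
  c ℤ.* (coeff f k ℤ.+ coeff g k)           ≡⟨ ℤₚ.*-distribˡ-+ c (coeff f k) _ ⟩
  c ℤ.* coeff f k ℤ.+ c ℤ.* coeff g k       ≡⟨ cong₂ ℤ._+_ (coeff-·P c f k) (coeff-·P c g k) ⟨
  coeff (c ·P f) k ℤ.+ coeff (c ·P g) k     ≡⟨ coeff-+P (c ·P f) (c ·P g) k ⟨
  coeff (c ·P f +P c ·P g) k                ∎
  where open ≡.≡-Reasoning

·P-assoc : ∀ c a g → (c ℤ.* a) ·P g ≐ c ·P (a ·P g)
·P-assoc c a g = mk≐ λ k → begin
  coeff ((c ℤ.* a) ·P g) k   ≡⟨ coeff-·P (c ℤ.* a) g k ⟩
  c ℤ.* a ℤ.* coeff g k      ≡⟨ ℤₚ.*-assoc c a (coeff g k) ⟩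
  c ℤ.* (a ℤ.* coeff g k)    ≡⟨ cong (c ℤ.*_) (coeff-·P a g k) ⟨
  c ℤ.* coeff (a ·P g) k     ≡⟨ coeff-·P c (a ·P g) k ⟨
  coeff (c ·P (a ·P g)) k    ∎
  where open ≡.≡-Reasoning

·P-neg : ∀ a g → (ℤ.- a) ·P g ≐ -P (a ·P g)
·P-neg a g = mk≐ λ k → begin
  coeff ((ℤ.- a) ·P g) k   ≡⟨ coeff-·P (ℤ.- a) g k ⟩
  ℤ.- a ℤ.* coeff g k      ≡⟨ ℤₚ.neg-distribˡ-* a (coeff g k) ⟨
  ℤ.- (a ℤ.* coeff g k)    ≡⟨ cong ℤ.-_ (coeff-·P a g k) ⟨
  ℤ.- coeff (a ·P g) k     ≡⟨ coeff-negP (a ·P g) k ⟨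
  coeff (-P (a ·P g)) k    ∎
  where open ≡.≡-Reasoning

·P-identity : ∀ g → + 1 ·P g ≐ g
·P-identity g = mk≐ λ k → ≡.trans (coeff-·P (+ 1) g k) (ℤₚ.*-identityˡ (coeff g k))

·P-zero : ∀ g → + 0 ·P g ≐ []
·P-zero g = mk≐ λ k → coeff-·P (+ 0) g k

*P-zeroʳ : ∀ f → f *P [] ≐ []
*P-zeroʳ []      = ≐-refl
*P-zeroʳ (a ∷ f) = mk≐ λ { zero → ≡.refl ; (suc k) → coeff-≡ (*P-zeroʳ f) k }

*P-distribʳ : ∀ f f' g → (f +P f') *P g ≐ f *P g +P f' *P g
*P-distribʳ []      f'       g = ≐-refl
*P-distribʳ (a ∷ f) []       g = ≐-sym (+P-identityʳ _)
*P-distribʳ (a ∷ f) (b ∷ f') g = begin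
  (a ℤ.+ b) ·P g +P (+ 0 ∷ (f +P f') *P g)                   ≈⟨ +P-cong (·P-distribʳ a b g) (∷-cong ≡.refl (*P-distribʳ f f' g)) ⟩
  (a ·P g +P b ·P g) +P ((+ 0 ∷ f *P g) +P (+ 0 ∷ f' *P g))  ≈⟨ +P.interchange (a ·P g) (b ·P g) _ _ ⟩
  (a ·P g +P (+ 0 ∷ f *P g)) +P (b ·P g +P (+ 0 ∷ f' *P g))  ∎
  where open ≐-Reasoning

*P-∷ˡ-zero : ∀ f g → (+ 0 ∷ f) *P g ≐ + 0 ∷ f *P g
*P-∷ˡ-zero f g = +P-cong (·P-zero g) (≐-refl {+ 0 ∷ f *P g})

*P-·P : ∀ c f g → (c ·P f) *P g ≐ c ·P (f *P g)
*P-·P c []      g = ≐-refl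
*P-·P c (a ∷ f) g = begin
  (c ℤ.* a) ·P g +P (+ 0 ∷ (c ·P f) *P g)   ≈⟨ +P-cong (·P-assoc c a g) (∷-cong (≡.sym (ℤₚ.*-zeroʳ c)) (*P-·P c f g)) ⟩
  c ·P (a ·P g) +P c ·P (+ 0 ∷ f *P g)      ≈⟨ ·P-distribˡ c (a ·P g) _ ⟨
  c ·P (a ·P g +P (+ 0 ∷ f *P g))           ∎
  where open ≐-Reasoning

*P-assoc : ∀ f g h → (f *P g) *P h ≐ f *P (g *P h)
*P-assoc []      g h = ≐-refl
*P-assoc (a ∷ f) g h = begin
  (a ·P g +P (+ 0 ∷ f *P g)) *P h             ≈⟨ *P-distribʳ (a ·P g) _ h ⟩
  (a ·P g) *P h +P (+ 0 ∷ f *P g) *P h        ≈⟨ +P-cong (*P-·P a g h) (*P-∷ˡ-zero (f *P g) h) ⟩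
  a ·P (g *P h) +P (+ 0 ∷ (f *P g) *P h)      ≈⟨ +P-congˡ (a ·P (g *P h)) (∷-cong ≡.refl (*P-assoc f g h)) ⟩
  a ·P (g *P h) +P (+ 0 ∷ f *P (g *P h))      ∎
  where open ≐-Reasoning

*P-∷ʳ : ∀ g a f → g *P (a ∷ f) ≐ a ·P g +P (+ 0 ∷ g *P f)
*P-∷ʳ []      a f = ≐-sym 0∷[]≐[]
*P-∷ʳ (b ∷ g) a f = ∷-cong (cong (ℤ._+ + 0) (ℤₚ.*-comm b a)) (begin
  b ·P f +P g *P (a ∷ f)                   ≈⟨ +P-congˡ (b ·P f) (*P-∷ʳ g a f) ⟩
  b ·P f +P (a ·P g +P (+ 0 ∷ g *P f))     ≈⟨ +P.x∙yz≈y∙xz (b ·P f) (a ·P g) _ ⟩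
  a ·P g +P (b ·P f +P (+ 0 ∷ g *P f))     ∎)
  where open ≐-Reasoning

*P-comm : ∀ f g → f *P g ≐ g *P f
*P-comm []      g = ≐-sym (*P-zeroʳ g)
*P-comm (a ∷ f) g = ≐-trans (+P-congˡ (a ·P g) (∷-cong ≡.refl (*P-comm f g))) (≐-sym (*P-∷ʳ g a f))

*P-identityˡ : ∀ g → 1P *P g ≐ g
*P-identityˡ g = ≐-trans (+P-cong (·P-identity g) 0∷[]≐[]) (+P-identityʳ g)

*P-negˡ : ∀ f g → (-P f) *P g ≐ -P (f *P g)
*P-negˡ []      g = ≐-refl
*P-negˡ (a ∷ f) g = begin
  (ℤ.- a) ·P g +P (+ 0 ∷ (-P f) *P g)     ≈⟨ +P-cong (·P-neg a g) (∷-cong ≡.refl (*P-negˡ f g)) ⟩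
  -P (a ·P g) +P -P (+ 0 ∷ f *P g)        ≈⟨ +P.⁻¹-∙-comm (a ·P g) _ ⟩
  -P (a ·P g +P (+ 0 ∷ f *P g))           ∎
  where open ≐-Reasoning


*P-constantʳ : ∀ u b → u *P (b ∷ []) ≐ b ·P u
*P-constantʳ u b = ≐-trans (*P-∷ʳ u b []) (≐-trans (+P-congˡ (b ·P u) (∷-cong ≡.refl (*P-zeroʳ u)))
                           (≐-trans (+P-congˡ (b ·P u) 0∷[]≐[]) (+P-identityʳ (b ·P u))))

coeff-*P-constantʳ : ∀ u b k → coeff (u *P (b ∷ [])) k ≡ b ℤ.* coeff u k
coeff-*P-constantʳ u b k = ≡.trans (coeff-≡ (*P-constantʳ u b) k) (coeff-·P b u k)

module Modulo (p : ℕ) where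
  open +-*-Solver using (solve; _:=_; _:+_; _:*_; _:-_; :-_; con)

  infix 4 _≈ₚ_
  record _≈ₚ_ (f g : Poly) : Set where
    constructor mk≈ₚ
    field coeff-∣ : ∀ k → + p ∣ coeff f k ℤ.- coeff g k
  open _≈ₚ_ public

  ≈[p]⇒≈ₚ : ∀ {f g} → f ≈[ p ] g → f ≈ₚ g
  ≈[p]⇒≈ₚ f≈g = mk≈ₚ λ k → ℤ∣.∣ᵤ⇒∣ (f≈g k)

  ≈ₚ⇒≈[p] : ∀ {f g} → f ≈ₚ g → f ≈[ p ] g
  ≈ₚ⇒≈[p] f≈g k = ℤ∣.∣⇒∣ᵤ (coeff-∣ f≈g k)

  ∣-≡ : ∀ {x y} → x ≡ y → + p ∣ x → + p ∣ y
  ∣-≡ = ≡.subst (+ p ∣_)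

  ∣0 : + p ∣ + 0
  ∣0 = divides (+ 0) ≡.refl

  ≐⇒≈ₚ : ∀ {f g} → f ≐ g → f ≈ₚ g
  ≐⇒≈ₚ {f} {g} f≐g = mk≈ₚ λ k →
    ∣-≡ (≡.sym (≡.trans (cong (ℤ._- coeff g k) (coeff-≡ f≐g k)) (ℤₚ.+-inverseʳ (coeff g k)))) ∣0

  ≈ₚ-sym : ∀ {f g} → f ≈ₚ g → g ≈ₚ f
  ≈ₚ-sym {f} {g} f≈g = mk≈ₚ λ k →
    ∣-≡ (solve 2 (λ a b → :- (a :- b) := b :- a) ≡.refl (coeff f k) (coeff g k)) (ℤ∣.∣m⇒∣-m (coeff-∣ f≈g k))

  ≈ₚ-trans : ∀ {f g h} → f ≈ₚ g → g ≈ₚ h → f ≈ₚ h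
  ≈ₚ-trans {f} {g} {h} f≈g g≈h = mk≈ₚ λ k →
    ∣-≡ (solve 3 (λ a b c → (a :- b) :+ (b :- c) := a :- c) ≡.refl (coeff f k) (coeff g k) (coeff h k))
        (ℤ∣.∣m∣n⇒∣m+n (coeff-∣ f≈g k) (coeff-∣ g≈h k))

  +P-cong-≈ₚ : ∀ {f f' g g'} → f ≈ₚ f' → g ≈ₚ g' → f +P g ≈ₚ f' +P g'
  +P-cong-≈ₚ {f} {f'} {g} {g'} f≈f' g≈g' = mk≈ₚ λ k → ∣-≡
    (≡.trans (solve 4 (λ a b a' b' → (a :- a') :+ (b :- b') := (a :+ b) :- (a' :+ b')) ≡.refl
                (coeff f k) (coeff g k) (coeff f' k) (coeff g' k))
             (≡.sym (cong₂ ℤ._-_ (coeff-+P f g k) (coeff-+P f' g' k))))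
    (ℤ∣.∣m∣n⇒∣m+n (coeff-∣ f≈f' k) (coeff-∣ g≈g' k))

  -P-cong-≈ₚ : ∀ {f f'} → f ≈ₚ f' → -P f ≈ₚ -P f'
  -P-cong-≈ₚ {f} {f'} f≈f' = mk≈ₚ λ k → ∣-≡
    (≡.trans (solve 2 (λ a a' → :- (a :- a') := (:- a) :- (:- a')) ≡.refl (coeff f k) (coeff f' k))
             (≡.sym (cong₂ ℤ._-_ (coeff-negP f k) (coeff-negP f' k))))
    (ℤ∣.∣m⇒∣-m (coeff-∣ f≈f' k))

  Vanishes : Poly → Set
  Vanishes u = ∀ k → + p ∣ coeff u k

  vanishes-*P : ∀ u g → Vanishes u → Vanishes (u *P g)
  vanishes-*P []      g _   k       = ∣0
  vanishes-*P (a ∷ u) g p∣u zero    =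
    ∣-≡ (≡.sym (coeff-*P-zero a u g)) (ℤ∣.∣m⇒∣m*n (coeff g 0) (p∣u 0))
  vanishes-*P (a ∷ u) g p∣u (suc k) =
    ∣-≡ (≡.sym (coeff-*P-suc a u g k))
        (ℤ∣.∣m∣n⇒∣m+n (ℤ∣.∣m⇒∣m*n (coeff g (suc k)) (p∣u 0)) (vanishes-*P u g (λ j → p∣u (suc j)) k))

  *P-congʳ-≈ₚ : ∀ g {f f'} → f ≈ₚ f' → f *P g ≈ₚ f' *P g
  *P-congʳ-≈ₚ g {f} {f'} f≈f' = mk≈ₚ λ k → ∣-≡
    (≡.trans (coeff-≡ (≐-trans (*P-distribʳ f (-P f') g) (+P-congˡ (f *P g) (*P-negˡ f' g))) k)
             (coeff-subP (f *P g) (f' *P g) k))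
    (vanishes-*P (f -P f') g (λ j → ∣-≡ (≡.sym (coeff-subP f f' j)) (coeff-∣ f≈f' j)) k)

  *P-cong-≈ₚ : ∀ {f f' g g'} → f ≈ₚ f' → g ≈ₚ g' → f *P g ≈ₚ f' *P g'
  *P-cong-≈ₚ {f} {f'} {g} {g'} f≈f' g≈g' = ≈ₚ-trans (*P-congʳ-≈ₚ g f≈f') (≈ₚ-trans
    (≐⇒≈ₚ (*P-comm f' g)) (≈ₚ-trans (*P-congʳ-≈ₚ f' g≈g') (≐⇒≈ₚ (*P-comm g' f'))))

  𝔽ₚ[X] : CommutativeRing _ _
  𝔽ₚ[X] = record
    { Carrier = Poly ; _≈_ = _≈ₚ_ ; _+_ = _+P_ ; _*_ = _*P_ ; -_ = -P_ ; 0# = [] ; 1# = 1P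
    ; isCommutativeRing = record
      { isRing = record
        { +-isAbelianGroup = record
          { isGroup = record
            { isMonoid = record
              { isSemigroup = record
                { isMagma = record
                  { isEquivalence = record { refl = ≐⇒≈ₚ ≐-refl ; sym = ≈ₚ-sym ; trans = ≈ₚ-trans }
                  ; ∙-cong = +P-cong-≈ₚ }
                ; assoc = λ f g h → ≐⇒≈ₚ (+P-assoc f g h) }
              ; identity = (λ f → ≐⇒≈ₚ ≐-refl) , (λ f → ≐⇒≈ₚ (+P-identityʳ f)) }
            ; inverse = (λ f → ≐⇒≈ₚ (AbelianGroup.inverseˡ +P-abelianGroup f)) , (λ f → ≐⇒≈ₚ (+P-inverseʳ f))
            ; ⁻¹-cong = -P-cong-≈ₚ }
          ; comm = λ f g → ≐⇒≈ₚ (+P-comm f g) }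
        ; *-cong = *P-cong-≈ₚ
        ; *-assoc = λ f g h → ≐⇒≈ₚ (*P-assoc f g h)
        ; *-identity = (λ f → ≐⇒≈ₚ (*P-identityˡ f)) , (λ f → ≐⇒≈ₚ (≐-trans (*P-comm f 1P) (*P-identityˡ f)))
        ; distrib = (λ f g h → ≐⇒≈ₚ (≐-trans (*P-comm f (g +P h)) (≐-trans (*P-distribʳ g h f) (+P-cong (*P-comm g f) (*P-comm h f)))))
                  , (λ f g h → ≐⇒≈ₚ (*P-distribʳ g h f)) }
      ; *-comm = λ f g → ≐⇒≈ₚ (*P-comm f g) } }

  infix 4 _HasDeg<_ _HasDeg_
  _HasDeg<_ : Poly → ℕ → Set
  u HasDeg< k = ∀ i → k ℕ.≤ i → + p ∣ coeff u i

  record _HasDeg_ (u : Poly) (d : ℕ) : Set where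
    constructor mkHasDeg
    field
      leading : ¬ + p ∣ coeff u d
      above   : u HasDeg< suc d
  open _HasDeg_ public

  degree-or-vanishes : ∀ u → Vanishes u ⊎ ∃ (u HasDeg_)
  degree-or-vanishes []      = inj₁ λ _ → ∣0
  degree-or-vanishes (a ∷ u) with degree-or-vanishes u
  ... | inj₂ (d , mkHasDeg lead above) = inj₂ (suc d , mkHasDeg lead λ { (suc i) (s≤s d<i) → above i d<i })
  ... | inj₁ p∣u with + p ℤ∣.∣? a
  ...   | yes p∣a = inj₁ λ { zero → p∣a ; (suc i) → p∣u i }
  ...   | no  p∤a = inj₂ (0 , mkHasDeg p∤a λ { (suc i) _ → p∣u i })

  HasDegree⇒HasDeg : ∀ {u d} → HasDegree p u d → u HasDeg d
  HasDegree⇒HasDeg (p∤lead , p∣above) = mkHasDeg (p∤lead ∘ ℤ∣.∣⇒∣ᵤ) λ i d<i → ℤ∣.∣ᵤ⇒∣ (p∣above i d<i)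

  HasDeg<⇒< : ∀ {r k m} → r HasDeg k → r HasDeg< m → k < m
  HasDeg<⇒< {k = k} {m} deg-r deg<r with k ℕ.<? m
  ... | yes k<m = k<m
  ... | no  k≮m = contradiction (deg<r k (ℕₚ.≮⇒≥ k≮m)) (leading deg-r)

  vanishes⇒≈ₚ[] : ∀ {u} → Vanishes u → u ≈ₚ []
  vanishes⇒≈ₚ[] {u} p∣u = mk≈ₚ λ k → ∣-≡ (≡.sym (ℤₚ.+-identityʳ (coeff u k))) (p∣u k)

  ∷-cong-≈ₚ : ∀ a {f g} → f ≈ₚ g → a ∷ f ≈ₚ a ∷ g
  ∷-cong-≈ₚ a f≈g = mk≈ₚ λ { zero → ∣-≡ (≡.sym (ℤₚ.+-inverseʳ a)) ∣0 ; (suc k) → coeff-∣ f≈g k }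

  take-≈ₚ : ∀ d u → u HasDeg< d → take d u ≈ₚ u
  take-≈ₚ zero    u       deg-u = ≈ₚ-sym (vanishes⇒≈ₚ[] λ i → deg-u i z≤n)
  take-≈ₚ (suc d) []      _     = ≐⇒≈ₚ ≐-refl
  take-≈ₚ (suc d) (a ∷ u) deg-u = ∷-cong-≈ₚ a (take-≈ₚ d u λ i d≤i → deg-u (suc i) (s≤s d≤i))

  *P-HasDeg< : ∀ u v {d e} → u HasDeg< d → v HasDeg< suc e → u *P v HasDeg< d ℕ.+ e
  *P-HasDeg< []      v         _     _     i _ = ∣0
  *P-HasDeg< (a ∷ u) v {zero}  deg-u _     i _ = vanishes-*P (a ∷ u) v (λ j → deg-u j z≤n) i
  *P-HasDeg< (a ∷ u) v {suc d} {e} deg-u deg-v (suc i) (s≤s d+e≤i) =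
    ∣-≡ (≡.sym (coeff-*P-suc a u v i))
      (ℤ∣.∣m∣n⇒∣m+n (ℤ∣.∣n⇒∣m*n a (deg-v (suc i) (s≤s (ℕₚ.≤-trans (ℕₚ.m≤n+m e d) d+e≤i))))
                    (*P-HasDeg< u v (λ j d≤j → deg-u (suc j) (s≤s d≤j)) deg-v i d+e≤i))

  coeff-*P-leading : ∀ u v {d e} → u HasDeg< suc d → v HasDeg< suc e →
                     + p ∣ coeff (u *P v) (d ℕ.+ e) ℤ.- coeff u d ℤ.* coeff v e
  coeff-*P-leading [] v {d} {e} _ _ = ∣-≡ (≡.sym (solve 1 (λ x → con (+ 0) :- con (+ 0) :* x := con (+ 0)) ≡.refl (coeff v e))) ∣0
  coeff-*P-leading (a ∷ u) v {zero} {zero} _ _ =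
    ∣-≡ (≡.sym (≡.trans (cong (ℤ._- a ℤ.* coeff v 0) (coeff-*P-zero a u v)) (ℤₚ.+-inverseʳ (a ℤ.* coeff v 0)))) ∣0
  coeff-*P-leading (a ∷ u) v {zero} {suc e} deg-u _ =
    ∣-≡ (≡.sym (≡.trans (cong (ℤ._- a ℤ.* coeff v (suc e)) (coeff-*P-suc a u v e))
                        (solve 2 (λ x y → x :+ y :- x := y) ≡.refl (a ℤ.* coeff v (suc e)) _)))
        (vanishes-*P u v (λ j → deg-u (suc j) (s≤s z≤n)) e)
  coeff-*P-leading (a ∷ u) v {suc d} {e} deg-u deg-v =
    ∣-≡ (≡.sym (≡.trans (cong (ℤ._- coeff u d ℤ.* coeff v e) (coeff-*P-suc a u v (d ℕ.+ e)))
                        (solve 3 (λ x y z → x :+ y :- z := x :+ (y :- z)) ≡.refl (a ℤ.* coeff v (suc (d ℕ.+ e))) _ _)))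
        (ℤ∣.∣m∣n⇒∣m+n (ℤ∣.∣n⇒∣m*n a (deg-v (suc (d ℕ.+ e)) (s≤s (ℕₚ.m≤n+m e d))))
                      (coeff-*P-leading u v (λ j d<j → deg-u (suc j) (s≤s d<j)) deg-v))

  HasDeg-unique : ∀ {u v d e} → u HasDeg d → v HasDeg e → u ≈ₚ v → d ≡ e
  HasDeg-unique {u} {v} {d} {e} deg-u deg-v u≈v with ℕₚ.<-cmp d e
  ... | tri≈ _ d≡e _ = d≡e
  ... | tri< d<e _ _ = contradiction
        (∣-≡ (solve 2 (λ x y → x :- (x :- y) := y) ≡.refl (coeff u e) _) (ℤ∣.∣m∣n⇒∣m-n (above deg-u e d<e) (coeff-∣ u≈v e)))
        (leading deg-v)
  ... | tri> _ _ e<d = contradiction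
        (∣-≡ (solve 2 (λ x y → (x :- y) :+ y := x) ≡.refl (coeff u d) _) (ℤ∣.∣m∣n⇒∣m+n (coeff-∣ u≈v d) (above deg-v d e<d)))
        (leading deg-u)

  HasDeg-constant : ∀ {a} → ¬ + p ∣ a → a ∷ [] HasDeg 0
  HasDeg-constant p∤a = mkHasDeg p∤a λ { (suc i) _ → ∣0 }

module ModuloPrime {p} (p-prime : Prime p) where
  open Modulo p
  open +-*-Solver using (solve; _:=_; _:+_; _:*_; _:-_; :-_; con)

  p∤1 : ¬ + p ∣ + 1
  p∤1 p∣1 = ¬prime[1] (≡.subst Prime (ℕ∣.∣1⇒≡1 (ℤ∣.∣⇒∣ᵤ p∣1)) p-prime)

  ∤-* : ∀ {a b} → ¬ + p ∣ a → ¬ + p ∣ b → ¬ + p ∣ a ℤ.* b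
  ∤-* {a} {b} p∤a p∤b p∣ab with euclidsLemma ℤ.∣ a ∣ ℤ.∣ b ∣ p-prime
                                  (≡.subst (p ℕ∣.∣_) (ℤₚ.abs-* a b) (ℤ∣.∣⇒∣ᵤ p∣ab))
  ... | inj₁ p∣a = p∤a (ℤ∣.∣ᵤ⇒∣ p∣a)
  ... | inj₂ p∣b = p∤b (ℤ∣.∣ᵤ⇒∣ p∣b)

  ∤⇒coprime : ∀ {n} → ¬ p ℕ∣.∣ n → Coprime n p
  ∤⇒coprime p∤n (d∣n , d∣p) with prime⇒irreducible p-prime d∣p
  ... | inj₁ d≡1   = d≡1
  ... | inj₂ ≡.refl = contradiction d∣n p∤n

  inverse-ℕ : ∀ n → ¬ p ℕ∣.∣ n → ∃ λ b → + p ∣ + n ℤ.* b ℤ.- + 1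
  inverse-ℕ n p∤n with coprime-Bézout (∤⇒coprime p∤n)
  ... | Bézout.+- x y 1+yp≡xn = + x , divides (+ y) (begin
    + n ℤ.* + x ℤ.- + 1              ≡⟨ cong (ℤ._- + 1) (ℤₚ.*-comm (+ n) (+ x)) ⟩
    + x ℤ.* + n ℤ.- + 1              ≡⟨ cong (ℤ._- + 1) (ℤₚ.pos-* x n) ⟨
    + (x ℕ.* n) ℤ.- + 1              ≡⟨ cong (λ m → + m ℤ.- + 1) 1+yp≡xn ⟨
    + (1 ℕ.+ y ℕ.* p) ℤ.- + 1        ≡⟨ cong (ℤ._- + 1) (≡.trans (ℤₚ.pos-+ 1 (y ℕ.* p)) (cong (ℤ._+_ (+ 1)) (ℤₚ.pos-* y p))) ⟩
    + 1 ℤ.+ + y ℤ.* + p ℤ.- + 1      ≡⟨ solve 2 (λ y p → con (+ 1) :+ y :* p :- con (+ 1) := y :* p) ≡.refl (+ y) (+ p) ⟩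
    + y ℤ.* + p                      ∎)
    where open ≡.≡-Reasoning
  ... | Bézout.-+ x y 1+xn≡yp = ℤ.- + x , divides (ℤ.- + y) (begin
    + n ℤ.* ℤ.- + x ℤ.- + 1          ≡⟨ solve 2 (λ n x → n :* (:- x) :- con (+ 1) := :- (con (+ 1) :+ x :* n)) ≡.refl (+ n) (+ x) ⟩
    ℤ.- (+ 1 ℤ.+ + x ℤ.* + n)        ≡⟨ cong ℤ.-_ (≡.trans (ℤₚ.pos-+ 1 (x ℕ.* n)) (cong (ℤ._+_ (+ 1)) (ℤₚ.pos-* x n))) ⟨
    ℤ.- + (1 ℕ.+ x ℕ.* n)            ≡⟨ cong (λ m → ℤ.- + m) 1+xn≡yp ⟩
    ℤ.- + (y ℕ.* p)                  ≡⟨ cong ℤ.-_ (ℤₚ.pos-* y p) ⟩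
    ℤ.- (+ y ℤ.* + p)                ≡⟨ ℤₚ.neg-distribˡ-* (+ y) (+ p) ⟩
    ℤ.- + y ℤ.* + p                  ∎)
    where open ≡.≡-Reasoning

  inverse : ∀ {a} → ¬ + p ∣ a → ∃ λ b → + p ∣ a ℤ.* b ℤ.- + 1
  inverse {+ n}     p∤a = inverse-ℕ n (p∤a ∘ ℤ∣.∣ᵤ⇒∣)
  inverse { -[1+ n ]} p∤a with inverse-ℕ (suc n) (p∤a ∘ ℤ∣.∣ᵤ⇒∣)
  ... | b , p∣nb-1 = ℤ.- b , ∣-≡ (cong (ℤ._- + 1) (solve 2 (λ a b → a :* b := (:- a) :* (:- b)) ≡.refl (+ suc n) b)) p∣nb-1

  *P-HasDeg : ∀ {u v d e} → u HasDeg d → v HasDeg e → u *P v HasDeg d ℕ.+ e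
  *P-HasDeg {u} {v} {d} {e} deg-u deg-v = mkHasDeg
    (λ p∣top → ∤-* (leading deg-u) (leading deg-v)
      (∣-≡ (solve 2 (λ x y → x :- (x :- y) := y) ≡.refl (coeff (u *P v) (d ℕ.+ e)) _)
           (ℤ∣.∣m∣n⇒∣m-n p∣top (coeff-*P-leading u v (above deg-u) (above deg-v)))))
    (*P-HasDeg< u v (above deg-u) (above deg-v))

  nonconstant∤constant : ∀ {g d a} k → g HasDeg d → 0 < d → ¬ + p ∣ a → ¬ a ∷ [] ≈ₚ g *P k
  nonconstant∤constant {g} {d} {a} k deg-g 0<d p∤a a≈gk with degree-or-vanishes k
  ... | inj₁ p∣k = p∤a (∣-≡ (solve 2 (λ x y → x :- y :+ y := x) ≡.refl a _)
          (ℤ∣.∣m∣n⇒∣m+n (coeff-∣ a≈gk 0) (∣-≡ (coeff-≡ (*P-comm k g) 0) (vanishes-*P k g p∣k 0))))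
  ... | inj₂ (e , deg-k) = ℕₚ.<⇒≢ (ℕₚ.<-≤-trans 0<d (ℕₚ.m≤m+n d e))
          (HasDeg-unique (HasDeg-constant p∤a) (*P-HasDeg deg-g deg-k) a≈gk)

  HasDeg-0⇒unit : ∀ {u} → u HasDeg 0 → ∃ λ w → u *P w ≈ₚ 1P
  HasDeg-0⇒unit {u} deg-u with inverse (leading deg-u)
  ... | b , p∣u₀b-1 = b ∷ [] , mk≈ₚ λ
    { zero    → ∣-≡ (cong (ℤ._- + 1) (≡.trans (ℤₚ.*-comm (coeff u 0) b) (≡.sym (coeff-*P-constantʳ u b 0))))
                    p∣u₀b-1
    ; (suc k) → ∣-≡ (≡.trans (≡.sym (ℤₚ.+-identityʳ _)) (cong (ℤ._+ + 0) (≡.sym (coeff-*P-constantʳ u b (suc k)))))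
                    (ℤ∣.∣n⇒∣m*n b (above deg-u (suc k) (s≤s z≤n))) }

  record Division (u v : Poly) (k : ℕ) : Set where
    constructor division
    field
      quotient remainder : Poly
      u≈qv+r             : u ≈ₚ quotient *P v +P remainder
      remainder-small    : remainder HasDeg< k

  divide : ∀ {v k} → v HasDeg k → ∀ u → Division u v k
  divide deg-v []      = division [] [] (≐⇒≈ₚ ≐-refl) λ _ _ → ∣0
  divide {v} {k} deg-v (a ∷ u) with divide deg-v u | inverse (leading deg-v)
  ... | division q r u≈qv+r deg-r | l , p∣vₖl-1 = division (c ∷ q) (w -P c ·P v) a∷u≈ deg-w-cv
    where
    w = a ∷ r
    c = coeff w k ℤ.* l
    a∷u≈ : a ∷ u ≈ₚ (c ∷ q) *P v +P (w -P c ·P v)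
    a∷u≈ = ≈ₚ-trans (∷-cong-≈ₚ a u≈qv+r) (≐⇒≈ₚ (≐-sym (begin
      (c ·P v +P (+ 0 ∷ q *P v)) +P (w +P -P (c ·P v))   ≈⟨ +P.assoc (c ·P v +P (+ 0 ∷ q *P v)) w _ ⟨
      ((c ·P v +P (+ 0 ∷ q *P v)) +P w) +P -P (c ·P v)   ≈⟨ +P-cong (+P.assoc (c ·P v) (+ 0 ∷ q *P v) w) (≐-refl { -P (c ·P v)}) ⟩
      (c ·P v +P ((+ 0 ∷ q *P v) +P w)) +P -P (c ·P v)   ≈⟨ +P.xyx⁻¹≈y (c ·P v) _ ⟩
      (+ 0 ∷ q *P v) +P w                                 ≈⟨ ∷-cong (ℤₚ.+-identityˡ a) ≐-refl ⟩
      a ∷ (q *P v +P r)                                   ∎)))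
      where open ≐-Reasoning
    coeff-w-cv : ∀ i → coeff (w -P c ·P v) i ≡ coeff w i ℤ.- c ℤ.* coeff v i
    coeff-w-cv i = ≡.trans (coeff-subP w (c ·P v) i) (cong (ℤ._-_ (coeff w i)) (coeff-·P c v i))
    deg-w-cv : w -P c ·P v HasDeg< k
    deg-w-cv i k≤i with ℕₚ.m≤n⇒m<n∨m≡n k≤i
    ... | inj₂ ≡.refl = ∣-≡
      (≡.sym (≡.trans (coeff-w-cv k) (solve 3 (λ t l vₖ → t :- (t :* l) :* vₖ := :- (t :* (vₖ :* l :- con (+ 1)))) ≡.refl (coeff w k) l (coeff v k))))
      (ℤ∣.∣m⇒∣-m (ℤ∣.∣n⇒∣m*n (coeff w k) p∣vₖl-1))
    ... | inj₁ (s≤s k≤i') = ∣-≡ (≡.sym (coeff-w-cv _))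
      (ℤ∣.∣m∣n⇒∣m-n (deg-r _ k≤i') (ℤ∣.∣n⇒∣m*n c (above deg-v _ (s≤s k≤i'))))

-- Rabin's test

module Rabin {p} (p-prime : Prime p) where
  open Modulo p
  open ModuloPrime p-prime
  open Quotient 𝔽ₚ[X]
  open SemiringExpProperties (CommutativeRing.semiring 𝔽ₚ[X]) using (_^_; ^-congˡ; ^-assocʳ)
  open SemiringMultProperties (CommutativeRing.semiring 𝔽ₚ[X]) using (_×_)
  open ℤ-Coefficients 𝔽ₚ[X] using (fromℤ)
  open Roots using (eval; LeadingNonzero; NoZeroDivisors; root-bound)
  private module 𝔽 = CommutativeRing 𝔽ₚ[X]

  ×-1P : ∀ n → n × 1P ≐ + n ∷ []
  ×-1P zero    = ≐-sym 0∷[]≐[]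
  ×-1P (suc n) = +P-congˡ 1P (×-1P n)

  char-p : p × 1P ≈ₚ []
  char-p = ≈ₚ-trans (≐⇒≈ₚ (×-1P p)) (mk≈ₚ λ
    { zero    → ∣-≡ (≡.sym (ℤₚ.+-identityʳ (+ p))) ℤ∣.∣-refl
    ; (suc k) → ∣0 })

  open Frobenius.CharacteristicP 𝔽ₚ[X] p-prime char-p using (fermat; eval-frobenius-^)

  fromℤ≈ₚ : ∀ z → fromℤ z ≈ₚ z ∷ []
  fromℤ≈ₚ (+ n)    = ≐⇒≈ₚ (×-1P n)
  fromℤ≈ₚ -[1+ n ] = ≐⇒≈ₚ (-P-cong (×-1P (suc n)))

  infix 9 _⟨_⟩
  _⟨_⟩ : Poly → Poly → Poly
  u ⟨ x ⟩ = eval 𝔽ₚ[X] (map fromℤ u) x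

  ⟨X⟩ : ∀ u → u ⟨ XP ⟩ ≈ₚ u
  ⟨X⟩ []      = 𝔽.refl
  ⟨X⟩ (a ∷ u) = ≈ₚ-trans (+P-cong-≈ₚ (fromℤ≈ₚ a) (𝔽.*-congˡ {XP} (⟨X⟩ u))) (≐⇒≈ₚ (begin
    (a ∷ []) +P XP *P u       ≈⟨ +P-congˡ (a ∷ []) (≐-trans (*P-∷ˡ-zero 1P u) (∷-cong ≡.refl (*P-identityˡ u))) ⟩
    (a ∷ []) +P (+ 0 ∷ u)     ≈⟨ ∷-cong (ℤₚ.+-identityʳ a) ≐-refl ⟩
    a ∷ u                     ∎))
    where open ≐-Reasoning

  ⟨^p^⟩ : ∀ u x i → u ⟨ x ^ (p ℕ.^ i) ⟩ ≈ₚ u ⟨ x ⟩ ^ (p ℕ.^ i)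
  ⟨^p^⟩ u x i = eval-frobenius-^ (map fromℤ u) x i (Allₚ.map⁺ (All.universal fermat u))

  X^p^ : ℕ → Poly
  X^p^ e = XP ^ (p ℕ.^ e)

  X^p^-+ : ∀ a b → X^p^ (a ℕ.+ b) ≈ₚ X^p^ a ^ (p ℕ.^ b)
  X^p^-+ a b = 𝔽.trans (𝔽.reflexive (cong (XP ^_) (ℕₚ.^-distribˡ-+-* p a b))) (𝔽.sym (^-assocʳ XP (p ℕ.^ a) (p ℕ.^ b)))

  ^-cong[mod] : ∀ {g x y} n → x ≈ y [mod g ] → x ^ n ≈ y ^ n [mod g ]
  ^-cong[mod] zero    _   = ≈⇒≈[mod] 𝔽.refl
  ^-cong[mod] (suc n) x≈y = [mod]-*-cong x≈y (^-cong[mod] n x≈y)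

  eval[mod] : ∀ g cs x → eval (quotientRing g) cs x ≡ eval 𝔽ₚ[X] cs x
  eval[mod] g []       x = ≡.refl
  eval[mod] g (a ∷ cs) x = cong (λ y → a +P x *P y) (eval[mod] g cs x)

  infix 4 _∣ₚ_
  _∣ₚ_ : Poly → Poly → Set
  g ∣ₚ f = ∃ λ c → f ≈ₚ g *P c

  ∣ₚ-trans : ∀ {r g f} → r ∣ₚ g → g ∣ₚ f → r ∣ₚ f
  ∣ₚ-trans {r} (c , g≈rc) (c' , f≈gc') = c *P c' , 𝔽.trans f≈gc' (𝔽.trans (𝔽.*-congʳ g≈rc) (𝔽.*-assoc r c c'))

  module _ {g d} (deg-g : g HasDeg d) (g-irreducible : ∀ {r k} → r HasDeg k → 0 < k → k < d → ¬ r ∣ₚ g) where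
    private
      module K = CommutativeRing (quotientRing g)
    open ℤ-Coefficients (quotientRing g) using (solve; _:=_; _:*_; _:+_; _:-_; con)
    open SetoidReasoning K.setoid

    -- Euclid's algorithm on g and a remainder r with r * b ≡ 0: every further remainder again
    -- annihilates b, and one that vanished would make its divisor a proper factor of g.
    no-zero-divisors : NoZeroDivisors (quotientRing g)
    no-zero-divisors {a} {b} ab≈0 a≉0 b≉0 with divide deg-g a
    ... | division q r a≈qg+r deg<r with degree-or-vanishes r
    ...   | inj₁ p∣r         = a≉0 (K.trans (≈q*g+r⇒≈r[mod] {q = q} {r = r} a≈qg+r) (≈⇒≈[mod] (vanishes⇒≈ₚ[] p∣r)))
    ...   | inj₂ (k , deg-r) = <-rec Descends descend k deg-r (HasDeg<⇒< deg-r deg<r)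
                                 (K.trans (K.*-congʳ {b} (K.sym (≈q*g+r⇒≈r[mod] {q = q} {r = r} a≈qg+r))) ab≈0)
      where
      Descends : ℕ → Set
      Descends k = ∀ {r} → r HasDeg k → k < d → r *P b ≈ [] [mod g ] → ⊥

      descend : ∀ k → (∀ {k'} → k' < k → Descends k') → Descends k
      descend zero    _   {r} deg-r _   rb≈0 with HasDeg-0⇒unit deg-r
      ... | w , rw≈1 = b≉0 (begin
        b               ≈⟨ K.*-identityˡ b ⟨
        1P *P b         ≈⟨ K.*-congʳ {b} (≈⇒≈[mod] (𝔽.trans (𝔽.*-comm w r) rw≈1)) ⟨
        (w *P r) *P b   ≈⟨ K.*-assoc w r b ⟩
        w *P (r *P b)   ≈⟨ K.*-congˡ {w} rb≈0 ⟩
        w *P []         ≈⟨ K.zeroʳ w ⟩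
        []              ∎)
      descend (suc k) rec {r} deg-r k<d rb≈0 with divide deg-r g
      ... | division q r' g≈qr+r' deg<r' with degree-or-vanishes r'
      ...   | inj₁ p∣r' = g-irreducible deg-r (s≤s z≤n) k<d (q , 𝔽.trans g≈qr+r'
              (𝔽.trans (𝔽.+-congˡ {q *P r} (vanishes⇒≈ₚ[] {r'} p∣r')) (𝔽.trans (𝔽.+-identityʳ (q *P r)) (𝔽.*-comm q r))))
      ...   | inj₂ (k' , deg-r') =
              rec k'<1+k deg-r' (ℕₚ.<-trans k'<1+k k<d) (begin
                r' *P b                                  ≈⟨ solve 4 (λ q r r' b → r' :* b := (q :* r :+ r') :* b :- q :* (r :* b)) K.refl q r r' b ⟩
                (q *P r +P r') *P b -P q *P (r *P b)     ≈⟨ K.+-cong (K.*-congʳ {b} (≈⇒≈[mod] (𝔽.sym g≈qr+r'))) (K.-‿cong (K.*-congˡ {q} rb≈0)) ⟩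
                g *P b -P q *P []                        ≈⟨ K.+-congʳ (K.*-congʳ {b} g≈0[mod]) ⟩
                [] *P b -P q *P []                       ≈⟨ solve 2 (λ q b → con (+ 0) :* b :- q :* con (+ 0) := con (+ 0)) K.refl q b ⟩
                []                                       ∎)
        where
        k'<1+k = HasDeg<⇒< deg-r' deg<r'

  module Periods (g : Poly) where
    Period : ℕ → Set
    Period e = X^p^ e ≈ XP [mod g ]

    period-shift : ∀ a b → Period a → X^p^ (a ℕ.+ b) ≈ X^p^ b [mod g ]
    period-shift a b period-a = [mod]-trans (≈⇒≈[mod] (X^p^-+ a b)) (^-cong[mod] (p ℕ.^ b) period-a)

    period-+ : ∀ a b → Period a → Period b → Period (a ℕ.+ b)
    period-+ a b period-a period-b = [mod]-trans (period-shift a b period-a) period-b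

    period-∸ : ∀ a b → Period a → Period (a ℕ.+ b) → Period b
    period-∸ a b period-a period-a+b = [mod]-trans ([mod]-sym (period-shift a b period-a)) period-a+b

  module _ {f n} (deg-f : f HasDeg n) (0<n : 0 < n)
           (X^p^n≈X : X^p^ n ≈ XP [mod f ])
           (X^p^m-X-invertible : ∀ t m → Prime t → n ≡ m ℕ.* t → ∃ λ b → b *P (X^p^ m -P XP) ≈ 1P [mod f ])
           where

    module Factor {a g' d} (deg-g : a ∷ g' HasDeg d) (0<d : 0 < d) (g∣f : a ∷ g' ∣ₚ f) where
      private
        g = a ∷ g'
        module K = CommutativeRing (quotientRing g)
      open Periods g

      constant≉0 : ∀ {z} → ¬ + p ∣ z → ¬ fromℤ z ≈ [] [mod g ]
      constant≉0 {z} p∤z z≈0 = nonconstant∤constant (quotient z∷[]≈0) deg-g 0<d p∤z (equality z∷[]≈0)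
        where
        z∷[]≈0 : z ∷ [] ≈ [] [mod g ]
        z∷[]≈0 = [mod]-trans (≈⇒≈[mod] (𝔽.sym (fromℤ≈ₚ z))) z≈0

      1≉0 : ¬ 1P ≈ [] [mod g ]
      1≉0 (mkMod k 1≈gk) = nonconstant∤constant k deg-g 0<d p∤1 1≈gk

      period-n : Period n
      period-n = [mod]-divisor g∣f X^p^n≈X

      no-short-period : ∀ {e} → 0 < e → e < n → ¬ Period e
      no-short-period {e} 0<e e<n period-e = cofactor-period (prime-cofactor 0<δ δ<n (gcd[m,n]∣n e n))
        where
        instance _ = ℕ.>-nonZero 0<e
        δ = gcd e n
        0<δ : 0 < δ
        0<δ = ℕₚ.n≢0⇒n>0 λ δ≡0 → ℕₚ.<⇒≢ 0<n (≡.sym (gcd[m,n]≡0⇒n≡0 e δ≡0))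
        δ<n : δ < n
        δ<n = ℕₚ.≤-<-trans (ℕ∣.∣⇒≤ (gcd[m,n]∣m e n)) e<n
        cofactor-period : (∃ λ t → ∃ λ m → Prime t Product.× n ≡ m ℕ.* t Product.× δ ℕ∣.∣ m) → ⊥
        cofactor-period (t , m , t-prime , n≡mt , ℕ∣.divides q m≡qδ) = 1≉0 (begin
          1P                    ≈⟨ [mod]-divisor g∣f b[X^p^m-X]≈1 ⟨
          b *P (X^p^ m -P XP)   ≈⟨ K.*-congˡ {b} (K.+-congʳ period-m) ⟩
          b *P (XP -P XP)       ≈⟨ ≈⇒≈[mod] (𝔽.trans (𝔽.*-congˡ {b} (𝔽.-‿inverseʳ XP)) (𝔽.zeroʳ b)) ⟩
          []                    ∎)
          where
          open SetoidReasoning K.setoid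
          b = proj₁ (X^p^m-X-invertible t m t-prime n≡mt)
          b[X^p^m-X]≈1 = proj₂ (X^p^m-X-invertible t m t-prime n≡mt)
          period-m : Period m
          period-m = ≡.subst Period (≡.sym m≡qδ)
            (P-multiple Period period-+ period-∸ δ q (P-gcd Period period-+ period-∸ e n period-e period-n))

      X^p^-distinct : ∀ {i j} → i < j → j < n → ¬ X^p^ i ≈ X^p^ j [mod g ]
      X^p^-distinct {i} {j} i<j j<n X^p^i≈X^p^j = no-short-period 0<e e<n (begin
        X^p^ (i ℕ.+ (n ℕ.∸ j))          ≈⟨ ≈⇒≈[mod] (X^p^-+ i (n ℕ.∸ j)) ⟩
        X^p^ i ^ (p ℕ.^ (n ℕ.∸ j))      ≈⟨ ^-cong[mod] (p ℕ.^ (n ℕ.∸ j)) X^p^i≈X^p^j ⟩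
        X^p^ j ^ (p ℕ.^ (n ℕ.∸ j))      ≈⟨ ≈⇒≈[mod] (X^p^-+ j (n ℕ.∸ j)) ⟨
        X^p^ (j ℕ.+ (n ℕ.∸ j))          ≡⟨ cong X^p^ (ℕₚ.m+[n∸m]≡n (ℕₚ.<⇒≤ j<n)) ⟩
        X^p^ n                          ≈⟨ period-n ⟩
        XP                              ∎)
        where
        open SetoidReasoning K.setoid
        0<e : 0 < i ℕ.+ (n ℕ.∸ j)
        0<e = ℕₚ.<-≤-trans (ℕₚ.m<n⇒0<n∸m j<n) (ℕₚ.m≤n+m (n ℕ.∸ j) i)
        e<n : i ℕ.+ (n ℕ.∸ j) < n
        e<n = ≡.subst (i ℕ.+ (n ℕ.∸ j) <_) (ℕₚ.m+[n∸m]≡n (ℕₚ.<⇒≤ j<n)) (ℕₚ.+-monoˡ-< (n ℕ.∸ j) i<j)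

      X^p^-root : ∀ i → take (suc d) g ⟨ X^p^ i ⟩ ≈ [] [mod g ]
      X^p^-root i = begin
        take (suc d) g ⟨ X^p^ i ⟩            ≈⟨ ≈⇒≈[mod] (⟨^p^⟩ (take (suc d) g) XP i) ⟩
        take (suc d) g ⟨ XP ⟩ ^ (p ℕ.^ i)    ≈⟨ ≈⇒≈[mod] (^-congˡ (p ℕ.^ i) (𝔽.trans (⟨X⟩ (take (suc d) g)) (take-≈ₚ (suc d) g (above deg-g)))) ⟩
        g ^ (p ℕ.^ i)                        ≈⟨ ^-cong[mod] (p ℕ.^ i) g≈0[mod] ⟩
        [] ^ (p ℕ.^ i)                       ≈⟨ ≈⇒≈[mod] (Frobenius.0#^n≈0# 𝔽ₚ[X] (p ℕ.^ i)) ⟩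
        []                                   ∎
        where
        open SetoidReasoning K.setoid
        instance
          _ = prime⇒nonZero p-prime
          _ = ℕₚ.m^n≢0 p i

      leading-nonzero : ∀ k c u → ¬ + p ∣ coeff (c ∷ u) k →
                        LeadingNonzero (quotientRing g) (fromℤ c) (map fromℤ (take k u))
      leading-nonzero zero    c []       p∤c = constant≉0 p∤c
      leading-nonzero zero    c (_ ∷ _)  p∤c = constant≉0 p∤c
      leading-nonzero (suc k) c []       p∤0 = ⊥-elim (p∤0 ∣0)
      leading-nonzero (suc k) c (c' ∷ u) p∤c = leading-nonzero k c' u p∤c

      n≤d : NoZeroDivisors (quotientRing g) → n ≤ d
      n≤d domain = begin
        n                                ≡⟨ Listₚ.length-applyUpTo X^p^ n ⟨
        length (applyUpTo X^p^ n)        ≤⟨ root-bound (quotientRing g) domain (fromℤ a) (map fromℤ (take d g'))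
                                              (leading-nonzero d a g' (leading deg-g)) (applyUpTo X^p^ n)
                                              (AllPairsₚ.applyUpTo⁺₁ X^p^ n X^p^-distinct)
                                              (Allₚ.applyUpTo⁺₂ X^p^ n roots) ⟩
        length (map fromℤ (take d g'))   ≡⟨ Listₚ.length-map fromℤ (take d g') ⟩
        length (take d g')               ≡⟨ Listₚ.length-take d g' ⟩
        d ℕ.⊓ length g'                  ≤⟨ ℕₚ.m⊓n≤m d (length g') ⟩
        d                                ∎
        where
        open ℕₚ.≤-Reasoning
        roots : ∀ i → ¬ ¬ eval (quotientRing g) (map fromℤ (take (suc d) g)) (X^p^ i) ≈ [] [mod g ]
        roots i ¬root = ¬root (≡.subst (_≈ [] [mod g ]) (≡.sym (eval[mod] g (map fromℤ (take (suc d) g)) (X^p^ i))) (X^p^-root i))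

    NoFactorOfDegree : ℕ → Set
    NoFactorOfDegree d = 0 < d → d < n → ∀ {g} → g HasDeg d → ¬ g ∣ₚ f

    no-factor : ∀ d → NoFactorOfDegree d
    no-factor = <-rec NoFactorOfDegree no-factor-below
      where
      no-factor-below : ∀ d → (∀ {k} → k < d → NoFactorOfDegree k) → NoFactorOfDegree d
      no-factor-below d IH 0<d d<n {[]}     deg-g g∣f = leading deg-g ∣0
      no-factor-below d IH 0<d d<n {a ∷ g'} deg-g g∣f = ℕₚ.<⇒≱ d<n (Factor.n≤d deg-g 0<d g∣f
        (no-zero-divisors deg-g λ {r} deg-r 0<k k<d r∣g →
          IH k<d 0<k (ℕₚ.<-trans k<d d<n) deg-r (∣ₚ-trans {r} r∣g g∣f)))

    irreducible : Irreducible p f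
    irreducible = f≉0 , f-not-unit , λ u v f≈uv →
      unit-factor u v (≈[p]⇒≈ₚ f≈uv) (degree-or-vanishes u) (degree-or-vanishes v)
      where
      f≉0 : ¬ f ≈[ p ] 0P
      f≉0 f≈0 = leading deg-f (∣-≡ (ℤₚ.+-identityʳ (coeff f n)) (coeff-∣ (≈[p]⇒≈ₚ {f} {0P} f≈0) n))

      f-not-unit : ¬ IsUnit p f
      f-not-unit (u , fu≈1) = nonconstant∤constant u deg-f 0<n p∤1 (≈ₚ-sym (≈[p]⇒≈ₚ fu≈1))

      unit : ∀ {u} → u HasDeg 0 → IsUnit p u
      unit deg-u = Product.map₂ ≈ₚ⇒≈[p] (HasDeg-0⇒unit deg-u)

      unit-factor : ∀ u v → f ≈ₚ u *P v → Vanishes u ⊎ ∃ (u HasDeg_) → Vanishes v ⊎ ∃ (v HasDeg_) →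
                    IsUnit p u ⊎ IsUnit p v
      unit-factor u v f≈uv (inj₁ p∣u) _ =
        ⊥-elim (f≉0 (≈ₚ⇒≈[p] (≈ₚ-trans f≈uv (vanishes⇒≈ₚ[] (vanishes-*P u v p∣u)))))
      unit-factor u v f≈uv (inj₂ _) (inj₁ p∣v) =
        ⊥-elim (f≉0 (≈ₚ⇒≈[p] (≈ₚ-trans f≈uv (≈ₚ-trans (≐⇒≈ₚ (*P-comm u v)) (vanishes⇒≈ₚ[] (vanishes-*P v u p∣v))))))
      unit-factor u v f≈uv (inj₂ (zero , deg-u)) (inj₂ _) = inj₁ (unit deg-u)
      unit-factor u v f≈uv (inj₂ (suc _ , _)) (inj₂ (zero , deg-v)) = inj₂ (unit deg-v)
      unit-factor u v f≈uv (inj₂ (suc du , deg-u)) (inj₂ (suc dv , deg-v)) =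
        ⊥-elim (no-factor (suc du) (s≤s z≤n) du<n deg-u (v , f≈uv))
        where
        du<n : suc du < n
        du<n = ≡.subst (suc du <_) (≡.sym (HasDeg-unique deg-f (*P-HasDeg deg-u deg-v) f≈uv))
                 (ℕₚ.m<m+n (suc du) (s≤s z≤n))

module Certificate {p} (p-prime : Prime p) (f : Poly) where
  open Modulo p
  open Quotient 𝔽ₚ[X]
  open Rabin p-prime
  open SemiringExpProperties (CommutativeRing.semiring 𝔽ₚ[X]) using (_^_; ^-assocʳ)
  private module K = SemiringExpProperties (CommutativeRing.semiring (quotientRing f))
  open SquareAndMultiply (quotientRing f) using (square-and-multiply)
  private module 𝔽 = CommutativeRing 𝔽ₚ[X]

  ^P≡^[mod] : ∀ u e → u ^P e ≡ u K.^ e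
  ^P≡^[mod] u zero    = ≡.refl
  ^P≡^[mod] u (suc e) = cong (u *P_) (^P≡^[mod] u e)

  ^P≡^ : ∀ u e → u ^P e ≡ u ^ e
  ^P≡^ u zero    = ≡.refl
  ^P≡^ u (suc e) = cong (u *P_) (^P≡^ u e)

  frobenius-step : ∀ s → p < 2 ℕ.^ suc s → ∀ x (y c : ℕ → Poly) →
    y s ≈[ p ] (x ^P bit p s) →
    (∀ j → j < s → (f *P c j) ≈[ p ] ((y (suc j) ^P 2) *P (x ^P bit p j) -P y j)) →
    y 0 ≈ x ^ p [mod f ]
  frobenius-step s p<2^s+1 x y c top step =
    ≡.subst (λ z → y 0 ≈ z [mod f ]) (≡.trans (≡.sym (^P≡^[mod] x p)) (^P≡^ x p))
      (square-and-multiply p s x y p<2^s+1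
        (≡.subst (λ z → y s ≈ z [mod f ]) (^P≡^[mod] x (bit p s)) (≈⇒≈[mod] (≈[p]⇒≈ₚ top)))
        λ j j<s → ≡.subst₂ (λ u v → y j ≈ u *P v [mod f ]) (^P≡^[mod] (y (suc j)) 2) (^P≡^[mod] x (bit p j))
                    ([mod]-sym (mkMod (c j) (≈ₚ-sym (≈[p]⇒≈ₚ (step j j<s))))))

  powers : ∀ {n} (h : ℕ → Poly) → h 0 ≈[ p ] XP → (∀ i → i < n → h (suc i) ≈ h i ^ p [mod f ]) →
           ∀ i → i ≤ n → h i ≈ X^p^ i [mod f ]
  powers h h₀≈X step zero    _     = ≈⇒≈[mod] (𝔽.trans (≈[p]⇒≈ₚ h₀≈X) (𝔽.sym (𝔽.*-identityʳ XP)))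
  powers h h₀≈X step (suc i) i<n =
    [mod]-trans (step i i<n) ([mod]-trans (^-cong[mod] p (powers h h₀≈X step i (ℕₚ.<⇒≤ i<n)))
      (≈⇒≈[mod] (𝔽.trans (^-assocʳ XP (p ℕ.^ i) p) (𝔽.reflexive (cong (XP ^_) (ℕₚ.*-comm (p ℕ.^ i) p))))))

open import Data.Nat using (_^_; _*_)

mainTheorem3 :
    (p : ℕ) → Prime p →
    (f : Poly) (n : ℕ) → 0 < n → HasDegree p f n →
    (s : ℕ) → 2 ^ s ≤ p → p < 2 ^ suc s →
    (h : ℕ → Poly) (g : ℕ → ℕ → Poly) (h' : ℕ → ℕ → Poly) (a b : ℕ → Poly) →
    (∀ i → i < n → h' i s ≈[ p ] (h i ^P bit p s)) →
    (∀ i → i < n → h' i 0 ≈[ p ] h (suc i)) →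
    (∀ i j → i < n → j < s →
      (f *P g i j) ≈[ p ] ((h' i (suc j) ^P 2) *P (h i ^P bit p j) -P h' i j)) →
    h 0 ≈[ p ] XP →
    h n ≈[ p ] XP →
    (∀ t m → Prime t → n ≡ m * t →
      ((a m *P f) +P (b m *P (h m -P XP))) ≈[ p ] 1P) →
    Irreducible p f
mainTheorem3 p p-prime f n 0<n deg-f s _ p<2^s+1 h g h' a b top-digit h'₀≈h step h₀≈X hₙ≈X bezout =
  irreducible (HasDegree⇒HasDeg deg-f) 0<n X^p^n≈X X^p^m-X-invertible
  where
  open Modulo p
  open Quotient 𝔽ₚ[X]
  open Rabin p-prime
  open Certificate p-prime f
  module Kf = CommutativeRing (quotientRing f)

  h≈X^p^ : ∀ i → i ≤ n → h i ≈ X^p^ i [mod f ]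
  h≈X^p^ = powers h h₀≈X λ i i<n →
    [mod]-trans (≈⇒≈[mod] (≈ₚ-sym (≈[p]⇒≈ₚ (h'₀≈h i i<n))))
                (frobenius-step s p<2^s+1 (h i) (h' i) (g i) (top-digit i i<n) (λ j → step i j i<n))

  X^p^n≈X : X^p^ n ≈ XP [mod f ]
  X^p^n≈X = [mod]-trans ([mod]-sym (h≈X^p^ n ℕₚ.≤-refl)) (≈⇒≈[mod] (≈[p]⇒≈ₚ hₙ≈X))

  X^p^m-X-invertible : ∀ t m → Prime t → n ≡ m ℕ.* t → ∃ λ c → c *P (X^p^ m -P XP) ≈ 1P [mod f ]
  X^p^m-X-invertible t m t-prime n≡mt = b m , Kf.trans
    (Kf.*-congˡ {b m} (Kf.+-congʳ { -P XP} ([mod]-sym (h≈X^p^ m m≤n))))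
    ([mod]-inverse {a = a m} {b = b m} {w = h m -P XP} (≈[p]⇒≈ₚ (bezout t m t-prime n≡mt)))
    where
    instance _ = prime⇒nonZero t-prime
    m≤n : m ≤ n
    m≤n = ≡.subst (m ≤_) (≡.sym n≡mt) (ℕₚ.m≤m*n m t)
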